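{- (1) Let the numbers $E_n(k)$ ($n\ge1$, $1\le k\le n$) be defined by $E_1(1)=1$, $E_n(n)=0$ for $n\ge2$, and $E_n(m+1)-E_n(m)+E_{n-1}(n-m)=0$ for $n\ge2$, $m=n-1,\dots,2,1$. Then for every $n\ge1$, $\sum_{k=1}^{2n-1}E_{2n-1}(k)=E_{2n-1}$ and $\sum_{k=1}^{2n}E_{2n}(k)=E_{2n}$. (2) Let $(A_n,B_n)_{n\ge2}$ be the twin Seidel matrix sequence, with entries $a_n(m,k)$, $b_n(m,k)$. Then for every $n\ge2$: $a_n(m,\bullet)=E_n(m)$ and $b_n(m,\bullet)=E_n(n+1-m)$ for $1\le m\le n$, and $a_n(\bullet,k)=b_n(\bullet,k)=E_n(n-k)$ for $1\le k\le n$, with the convention $E_n(0)=0$.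
   Context: $E_n$ are the tangent/secant numbers: $\sum_{n\ge0}E_nu^n/n!=\tan u+\sec u$. Row and column sums: $a_n(m,\bullet)=\sum_k a_n(m,k)$, $a_n(\bullet,k)=\sum_m a_n(m,k)$, similarly for $b$. Twin Seidel matrix sequence: the unique sequence of square matrices $A_n=(a_n(m,k))_{1\le m,k\le n}$, $B_n=(b_n(m,k))_{1\le m,k\le n}$ ($n\ge2$) with nonnegative integer entries satisfying: (TS1) all diagonal entries are $0$, except $a_2(1,1)=1$; (TS2) for $n\ge3$: $a_n(m,n)=b_n(m,n)=0$ for all $m$, $a_n(n,k)=b_n(1,k)=0$ for all $k$, and $b_n(n,1)=0$; (TS3) $A_2=\begin{pmatrix}1&0\\0&0\end{pmatrix}$, $B_2=\begin{pmatrix}0&0\\1&0\end{pmatrix}$; (TS4) for $n\ge3$: $b_n(n,k)=a_{n-1}(\bullet,k-1)$ for $2\le k\le n-1$; $b_n(n-1,k)=a_{n-1}(\bullet,k)$ for $1\le k\le n-2$; $b_n(m+1,k)-b_n(m,k)=a_{n-1}(m,k)$ for $2\le k+1\le m\le n-2$; $b_n(m+1,k)-b_n(m,k)=a_{n-1}(m,k-1)$ for $3\le m+2\le k\le n-1$; (TS5) for $n\ge3$: $a_n(1,k)=b_{n-1}(\bullet,k-1)$ for $2\le k\le n-1$; $a_n(m+1,k)-a_n(m,k)=-b_{n-1}(m,k-1)$ for $3\le m+2\le k\le n-1$; $a_n(m+1,k)-a_n(m,k)=-b_{n-1}(m,k)$ for $2\le k+1\le m\le n-1$. -}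

module Defs where

open import Data.Nat using (ℕ; zero; suc; _+_; _*_; _∸_; _≤_)
open import Data.Nat.Combinatorics using (_C_)
open import Data.Integer as ℤ using (ℤ; +_; -_)
open import Data.Product using (_×_)
open import Relation.Binary.PropositionalEquality using (_≡_)
open import Relation.Nullary using (¬_)

Σ₁ : ℕ → (ℕ → ℕ) → ℕ
Σ₁ zero    f = 0
Σ₁ (suc n) f = Σ₁ n f + f (suc n)

Σℤ₁ : ℕ → (ℕ → ℤ) → ℤ
Σℤ₁ zero    f = + 0
Σℤ₁ (suc n) f = Σℤ₁ n f ℤ.+ f (suc n)

Σℤ₀ : ℕ → (ℕ → ℤ) → ℤ
Σℤ₀ n f = f 0 ℤ.+ Σℤ₁ n f

-- Tangent/secant numbers via their exponential generating function.
-- cosD j = j-th derivative of cos at 0,  sinD j = j-th derivative of sin at 0,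
-- so cos u = Σ cosD j u^j/j!,  sin u = Σ sinD j u^j/j!.

cosD : ℕ → ℤ
cosD zero          = + 1
cosD (suc zero)    = + 0
cosD (suc (suc j)) = - cosD j

sinD : ℕ → ℤ
sinD zero          = + 0
sinD (suc zero)    = + 1
sinD (suc (suc j)) = - sinD j

δ₀ : ℕ → ℤ
δ₀ zero    = + 1
δ₀ (suc _) = + 0

-- E is the EGF-coefficient sequence of tan u + sec u = (1 + sin u) / cos u,
-- i.e. (Σ E_n u^n/n!) · cos u = 1 + sin u as formal power series.
-- Comparing coefficients of u^N and multiplying by N! gives:
IsTanSec : (ℕ → ℤ) → Set
IsTanSec E = ∀ N →
  Σℤ₀ N (λ k → (+ (N C k)) ℤ.* E k ℤ.* cosD (N ∸ k)) ≡ δ₀ N ℤ.+ sinD N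

-- The numbers E_n(k), n ≥ 1, 1 ≤ k ≤ n (values outside this range are
-- irrelevant and unconstrained).

IsEntringer : (ℕ → ℕ → ℤ) → Set
IsEntringer F =
    (F 1 1 ≡ + 1)
  × (∀ n → 2 ≤ n → F n n ≡ + 0)
  × (∀ n m → 2 ≤ n → 1 ≤ m → m ≤ n ∸ 1 →
       F n (suc m) ℤ.- F n m ℤ.+ F (n ∸ 1) (n ∸ m) ≡ + 0)

withZero : (ℕ → ℕ → ℤ) → ℕ → ℕ → ℤ
withZero F n zero    = + 0
withZero F n (suc k) = F n (suc k)

-- Twin Seidel matrix sequences.  A n m k = a_n(m,k), B n m k = b_n(m,k),
-- meaningful for n ≥ 2 and 1 ≤ m, k ≤ n.

Mat : Set
Mat = ℕ → ℕ → ℕ → ℕ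

rowSum : Mat → ℕ → ℕ → ℕ
rowSum A n m = Σ₁ n (λ k → A n m k)

colSum : Mat → ℕ → ℕ → ℕ
colSum A n k = Σ₁ n (λ m → A n m k)

IsTwinSeidel : Mat → Mat → Set
IsTwinSeidel A B =
  -- (TS1)
    (∀ n m → 2 ≤ n → 1 ≤ m → m ≤ n → ¬ (n ≡ 2 × m ≡ 1) → A n m m ≡ 0)
  × (∀ n m → 2 ≤ n → 1 ≤ m → m ≤ n → B n m m ≡ 0)
  -- (TS2)
  × (∀ n m → 3 ≤ n → 1 ≤ m → m ≤ n → A n m n ≡ 0 × B n m n ≡ 0)
  × (∀ n k → 3 ≤ n → 1 ≤ k → k ≤ n → A n n k ≡ 0 × B n 1 k ≡ 0)
  × (∀ n → 3 ≤ n → B n n 1 ≡ 0)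
  -- (TS3)
  × (A 2 1 1 ≡ 1 × A 2 1 2 ≡ 0 × A 2 2 1 ≡ 0 × A 2 2 2 ≡ 0)
  × (B 2 1 1 ≡ 0 × B 2 1 2 ≡ 0 × B 2 2 1 ≡ 1 × B 2 2 2 ≡ 0)
  -- (TS4)
  × (∀ n k → 3 ≤ n → 2 ≤ k → k ≤ n ∸ 1 →
       B n n k ≡ colSum A (n ∸ 1) (k ∸ 1))
  × (∀ n k → 3 ≤ n → 1 ≤ k → k ≤ n ∸ 2 →
       B n (n ∸ 1) k ≡ colSum A (n ∸ 1) k)
  × (∀ n m k → 3 ≤ n → 2 ≤ k + 1 → k + 1 ≤ m → m ≤ n ∸ 2 →
       B n (m + 1) k ≡ B n m k + A (n ∸ 1) m k)
  × (∀ n m k → 3 ≤ n → 3 ≤ m + 2 → m + 2 ≤ k → k ≤ n ∸ 1 →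
       B n (m + 1) k ≡ B n m k + A (n ∸ 1) m (k ∸ 1))
  -- (TS5)
  × (∀ n k → 3 ≤ n → 2 ≤ k → k ≤ n ∸ 1 →
       A n 1 k ≡ colSum B (n ∸ 1) (k ∸ 1))
  × (∀ n m k → 3 ≤ n → 3 ≤ m + 2 → m + 2 ≤ k → k ≤ n ∸ 1 →
       A n m k ≡ A n (m + 1) k + B (n ∸ 1) m (k ∸ 1))
  × (∀ n m k → 3 ≤ n → 2 ≤ k + 1 → k + 1 ≤ m → m ≤ n ∸ 1 →
       A n m k ≡ A n (m + 1) k + B (n ∸ 1) m k)

module Submission where

-- Read the Entringer numbers along anti-diagonals, Φ a b = E_{a+b+1}(a+1). The defining recurrence
-- becomes Φ(a+1,b) = Φ(a,b+1) − Φ(b,a), a rotation in the pair (Φ, Φᵀ) whose solution is a binomial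
-- convolution of boundary values with the derivatives of cos and sin at 0. For the first column this
-- is exactly the identity (Σ E_n u^n/n!) cos u = 1 + sin u characterising tan + sec, and row sums
-- telescope to the first column: that is part (1).
-- For the twin Seidel matrices argue by induction on n. Consecutive rows differ, via (TS4)/(TS5), by
-- rows one level down, which mirrors the Entringer recurrence. A column splits into diagonal chains
-- that obey the same rotation recurrence; summing them (a hockey-stick identity) expresses the column
-- sum through Entringer numbers of lower levels, and the remaining convolution identities for Φ are
-- proved by one more induction along the same recurrence.

open import Defs
open import Data.Nat using (ℕ; zero; suc; _+_; _*_; _∸_; _≤_; _<_; z≤n; s≤s)
import Data.Nat.Properties as ℕP
open import Data.Nat.Induction using (<-rec)
open import Data.Nat.Combinatorics using (_C_; k>n⇒nCk≡0; nCk+nC[k+1]≡[n+1]C[k+1]; nCn≡1)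
open import Data.Integer as ℤ using (ℤ; +_)
import Data.Integer.Properties as ℤP
open import Data.Integer.Tactic.RingSolver using (solve-∀)
open import Data.Product using (_×_; _,_; proj₁; proj₂)
open import Data.Sum using (inj₁; inj₂)
open import Function using (_∘_)
open import Relation.Binary.PropositionalEquality using (_≡_; refl; sym; trans; cong; cong₂; subst; module ≡-Reasoning)
open import Relation.Nullary using (¬_)

Σ< : ℕ → (ℕ → ℤ) → ℤ
Σ< zero    f = + 0
Σ< (suc n) f = Σ< n f ℤ.+ f n

Σ<-cong< : ∀ n {f g : ℕ → ℤ} → (∀ i → i < n → f i ≡ g i) → Σ< n f ≡ Σ< n g
Σ<-cong< zero    f≡g = refl
Σ<-cong< (suc n) f≡g =
  cong₂ ℤ._+_ (Σ<-cong< n (λ i i<n → f≡g i (ℕP.m<n⇒m<1+n i<n))) (f≡g n (ℕP.n<1+n n))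

Σ<-cong : ∀ n {f g : ℕ → ℤ} → (∀ i → f i ≡ g i) → Σ< n f ≡ Σ< n g
Σ<-cong n f≡g = Σ<-cong< n (λ i _ → f≡g i)

Σ<-+ : ∀ n (f g : ℕ → ℤ) → Σ< n (λ i → f i ℤ.+ g i) ≡ Σ< n f ℤ.+ Σ< n g
Σ<-+ zero    f g = refl
Σ<-+ (suc n) f g rewrite Σ<-+ n f g = middle-swap (Σ< n f) (Σ< n g) (f n) (g n)
  where
  middle-swap : ∀ a b c d → a ℤ.+ b ℤ.+ (c ℤ.+ d) ≡ a ℤ.+ c ℤ.+ (b ℤ.+ d)
  middle-swap = solve-∀

Σ<-neg : ∀ n (f : ℕ → ℤ) → Σ< n (λ i → ℤ.- f i) ≡ ℤ.- Σ< n f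
Σ<-neg zero    f = refl
Σ<-neg (suc n) f rewrite Σ<-neg n f = sym (ℤP.neg-distrib-+ (Σ< n f) (f n))

Σ<-zero : ∀ n (f : ℕ → ℤ) → (∀ i → i < n → f i ≡ + 0) → Σ< n f ≡ + 0
Σ<-zero n f f≡0 = trans (Σ<-cong< n f≡0) (zeros n)
  where
  zeros : ∀ n → Σ< n (λ _ → + 0) ≡ + 0
  zeros zero    = refl
  zeros (suc n) = cong (λ z → z ℤ.+ + 0) (zeros n)

Σ<-suc : ∀ n (f : ℕ → ℤ) → Σ< (suc n) f ≡ f 0 ℤ.+ Σ< n (f ∘ suc)
Σ<-suc zero    f = ℤP.+-comm (+ 0) (f 0)
Σ<-suc (suc n) f rewrite Σ<-suc n f = ℤP.+-assoc (f 0) (Σ< n (f ∘ suc)) (f (suc n))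

Σ<-+-split : ∀ a b (f : ℕ → ℤ) → Σ< (a + b) f ≡ Σ< a f ℤ.+ Σ< b (λ i → f (a + i))
Σ<-+-split a zero    f = trans (cong (λ z → Σ< z f) (ℕP.+-identityʳ a)) (sym (ℤP.+-identityʳ _))
Σ<-+-split a (suc b) f =
  trans (cong (λ z → Σ< z f) (ℕP.+-suc a b))
   (trans (cong (λ z → z ℤ.+ f (a + b)) (Σ<-+-split a b f))
          (ℤP.+-assoc (Σ< a f) (Σ< b (λ i → f (a + i))) (f (a + b))))

Σ<-reverse : ∀ n (f : ℕ → ℤ) → Σ< n (λ i → f (n ∸ suc i)) ≡ Σ< n f
Σ<-reverse zero    f = refl
Σ<-reverse (suc n) f =
  trans (Σ<-suc n (λ i → f (suc n ∸ suc i)))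
   (trans (cong (λ z → f n ℤ.+ z) (Σ<-reverse n f)) (ℤP.+-comm (f n) (Σ< n f)))

Σ₁≡Σ< : ∀ n (f : ℕ → ℤ) → Σℤ₁ n f ≡ Σ< n (f ∘ suc)
Σ₁≡Σ< zero    f = refl
Σ₁≡Σ< (suc n) f = cong (λ z → z ℤ.+ f (suc n)) (Σ₁≡Σ< n f)

Σ₀≡Σ< : ∀ n (f : ℕ → ℤ) → Σℤ₀ n f ≡ Σ< (suc n) f
Σ₀≡Σ< n f = trans (cong (λ z → f 0 ℤ.+ z) (Σ₁≡Σ< n f)) (sym (Σ<-suc n f))

+Σ₁≡Σ< : ∀ n (f : ℕ → ℕ) → + (Σ₁ n f) ≡ Σ< n (λ i → + f (suc i))
+Σ₁≡Σ< zero    f = refl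
+Σ₁≡Σ< (suc n) f = trans (ℤP.pos-+ (Σ₁ n f) (f (suc n))) (cong (λ z → z ℤ.+ + f (suc n)) (+Σ₁≡Σ< n f))

-- Binomial convolution and the derivatives of cos and sin

-- The coefficients of the product of two exponential generating functions.
conv : (ℕ → ℤ) → (ℕ → ℤ) → ℕ → ℤ
conv f g N = Σ< (suc N) (λ k → + (N C k) ℤ.* f k ℤ.* g (N ∸ k))

conv-cong : ∀ {f f′ g g′ : ℕ → ℤ} N → (∀ i → f i ≡ f′ i) → (∀ i → g i ≡ g′ i) →
            conv f g N ≡ conv f′ g′ N
conv-cong N f≡f′ g≡g′ =
  Σ<-cong (suc N) (λ k → cong₂ (λ x y → + (N C k) ℤ.* x ℤ.* y) (f≡f′ k) (g≡g′ (N ∸ k)))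

conv-congˡ : ∀ {f f′ : ℕ → ℤ} g N → (∀ i → i ≤ N → f i ≡ f′ i) → conv f g N ≡ conv f′ g N
conv-congˡ g N f≡f′ =
  Σ<-cong< (suc N) (λ k k≤N → cong (λ x → + (N C k) ℤ.* x ℤ.* g (N ∸ k)) (f≡f′ k (ℕP.≤-pred k≤N)))

conv-last : ∀ (f g : ℕ → ℤ) N →
            conv f g N ≡ Σ< N (λ k → + (N C k) ℤ.* f k ℤ.* g (N ∸ k)) ℤ.+ f N ℤ.* g 0
conv-last f g N = cong (λ z → Σ< N (λ k → + (N C k) ℤ.* f k ℤ.* g (N ∸ k)) ℤ.+ z)
  (trans (cong₂ (λ a b → + a ℤ.* f N ℤ.* g b) (nCn≡1 N) (ℕP.n∸n≡0 N))
         (cong (λ x → x ℤ.* g 0) (ℤP.*-identityˡ (f N))))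

conv-congˡ< : ∀ {f f′ : ℕ → ℤ} g N → (∀ i → i < N → f i ≡ f′ i) → g 0 ≡ + 0 →
              conv f g N ≡ conv f′ g N
conv-congˡ< {f} {f′} g N f≡f′ g0≡0 =
  trans (conv-last f g N) (trans (cong₂ ℤ._+_ heads (lastVanishes f′)) (sym (conv-last f′ g N)))
  where
  heads : Σ< N (λ k → + (N C k) ℤ.* f k ℤ.* g (N ∸ k)) ≡ Σ< N (λ k → + (N C k) ℤ.* f′ k ℤ.* g (N ∸ k))
  heads = Σ<-cong< N (λ k k<N → cong (λ x → + (N C k) ℤ.* x ℤ.* g (N ∸ k)) (f≡f′ k k<N))
  lastVanishes : ∀ h → f N ℤ.* g 0 ≡ h N ℤ.* g 0
  lastVanishes h = trans (cong (λ z → f N ℤ.* z) g0≡0)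
                  (trans (ℤP.*-zeroʳ (f N)) (sym (trans (cong (λ z → h N ℤ.* z) g0≡0) (ℤP.*-zeroʳ (h N)))))

-- When g 0 = 1, the top term f N cancels, so f N − conv f g N only sees f below N.
sub-conv-congˡ< : ∀ (f f′ g : ℕ → ℤ) N → g 0 ≡ + 1 → (∀ i → i < N → f i ≡ f′ i) →
                  f N ℤ.- conv f g N ≡ f′ N ℤ.- conv f′ g N
sub-conv-congˡ< f f′ g N g0≡1 f≡f′ =
  trans (cancelTop f) (trans (cong ℤ.-_ heads) (sym (cancelTop f′)))
  where
  heads : Σ< N (λ k → + (N C k) ℤ.* f k ℤ.* g (N ∸ k)) ≡ Σ< N (λ k → + (N C k) ℤ.* f′ k ℤ.* g (N ∸ k))
  heads = Σ<-cong< N (λ k k<N → cong (λ x → + (N C k) ℤ.* x ℤ.* g (N ∸ k)) (f≡f′ k k<N))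
  cancel : ∀ x S → x ℤ.- (S ℤ.+ x ℤ.* + 1) ≡ ℤ.- S
  cancel = solve-∀
  cancelTop : ∀ h → h N ℤ.- conv h g N ≡ ℤ.- Σ< N (λ k → + (N C k) ℤ.* h k ℤ.* g (N ∸ k))
  cancelTop h rewrite conv-last h g N | g0≡1 = cancel (h N) _

conv-+ˡ : ∀ (f f′ g : ℕ → ℤ) N → conv (λ i → f i ℤ.+ f′ i) g N ≡ conv f g N ℤ.+ conv f′ g N
conv-+ˡ f f′ g N = trans (Σ<-cong (suc N) (λ k → distrib (+ (N C k)) (f k) (f′ k) (g (N ∸ k)))) (Σ<-+ (suc N) _ _)
  where
  distrib : ∀ a x y z → a ℤ.* (x ℤ.+ y) ℤ.* z ≡ a ℤ.* x ℤ.* z ℤ.+ a ℤ.* y ℤ.* z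
  distrib = solve-∀

conv-negˡ : ∀ (f g : ℕ → ℤ) N → conv (λ i → ℤ.- f i) g N ≡ ℤ.- conv f g N
conv-negˡ f g N = trans (Σ<-cong (suc N) (λ k → pull (+ (N C k)) (f k) (g (N ∸ k)))) (Σ<-neg (suc N) _)
  where
  pull : ∀ a x z → a ℤ.* (ℤ.- x) ℤ.* z ≡ ℤ.- (a ℤ.* x ℤ.* z)
  pull = solve-∀

conv-negʳ : ∀ (f g : ℕ → ℤ) N → conv f (λ i → ℤ.- g i) N ≡ ℤ.- conv f g N
conv-negʳ f g N = trans (Σ<-cong (suc N) (λ k → pull (+ (N C k)) (f k) (g (N ∸ k)))) (Σ<-neg (suc N) _)
  where
  pull : ∀ a x z → a ℤ.* x ℤ.* (ℤ.- z) ≡ ℤ.- (a ℤ.* x ℤ.* z)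
  pull = solve-∀

conv-zeroˡ : ∀ (f g : ℕ → ℤ) N → (∀ i → f i ≡ + 0) → conv f g N ≡ + 0
conv-zeroˡ f g N f≡0 = Σ<-zero (suc N) _ (λ k _ → trans (cong (λ x → + (N C k) ℤ.* x ℤ.* g (N ∸ k)) (f≡0 k)) (vanish (+ (N C k)) (g (N ∸ k))))
  where
  vanish : ∀ a z → a ℤ.* + 0 ℤ.* z ≡ + 0
  vanish = solve-∀

conv-0 : ∀ (f g : ℕ → ℤ) → conv f g 0 ≡ f 0 ℤ.* g 0
conv-0 f g = unit (f 0) (g 0)
  where
  unit : ∀ x y → + 0 ℤ.+ + 1 ℤ.* x ℤ.* y ≡ x ℤ.* y
  unit = solve-∀

conv-δˡ : ∀ (f g : ℕ → ℤ) N → f 0 ≡ + 1 → (∀ i → f (suc i) ≡ + 0) → conv f g N ≡ g N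
conv-δˡ f g N f0≡1 fs≡0 =
  trans (Σ<-suc N _)
   (trans (cong₂ ℤ._+_ (cong (λ x → + 1 ℤ.* x ℤ.* g N) f0≡1) (Σ<-zero N _ tailVanishes)) (unit (g N)))
  where
  vanish : ∀ a z → a ℤ.* + 0 ℤ.* z ≡ + 0
  vanish = solve-∀
  unit : ∀ y → + 1 ℤ.* + 1 ℤ.* y ℤ.+ + 0 ≡ y
  unit = solve-∀
  tailVanishes : ∀ k → k < N → + (N C suc k) ℤ.* f (suc k) ℤ.* g (N ∸ suc k) ≡ + 0
  tailVanishes k _ = trans (cong (λ x → + (N C suc k) ℤ.* x ℤ.* g (N ∸ suc k)) (fs≡0 k)) (vanish (+ (N C suc k)) (g (N ∸ suc k)))

-- Pascal's rule splits the binomial coefficient; the two halves are the two convolutions.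
conv-leibniz : ∀ (f g : ℕ → ℤ) N → conv f g (suc N) ≡ conv (f ∘ suc) g N ℤ.+ conv f (g ∘ suc) N
conv-leibniz f g N =
  begin
    conv f g (suc N)
  ≡⟨ Σ<-suc (suc N) _ ⟩
    h₀ ℤ.+ Σ< (suc N) (λ k → + (suc N C suc k) ℤ.* f (suc k) ℤ.* g (N ∸ k))
  ≡⟨ cong (λ z → h₀ ℤ.+ z) (trans (Σ<-cong (suc N) pascal) (Σ<-+ (suc N) P T)) ⟩
    h₀ ℤ.+ (conv (f ∘ suc) g N ℤ.+ (Σ< N T ℤ.+ T N))
  ≡⟨ cong (λ z → h₀ ℤ.+ (conv (f ∘ suc) g N ℤ.+ (Σ< N T ℤ.+ z))) topVanishes ⟩
    h₀ ℤ.+ (conv (f ∘ suc) g N ℤ.+ (Σ< N T ℤ.+ + 0))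
  ≡⟨ rearrange h₀ (conv (f ∘ suc) g N) (Σ< N T) ⟩
    conv (f ∘ suc) g N ℤ.+ (h₀ ℤ.+ Σ< N T)
  ≡⟨ cong (λ z → conv (f ∘ suc) g N ℤ.+ (h₀ ℤ.+ z)) (Σ<-cong< N reindex) ⟩
    conv (f ∘ suc) g N ℤ.+ (h₀ ℤ.+ Σ< N T′)
  ≡⟨ cong (λ z → conv (f ∘ suc) g N ℤ.+ z) (sym (Σ<-suc N _)) ⟩
    conv (f ∘ suc) g N ℤ.+ conv f (g ∘ suc) N
  ∎
  where
  open ≡-Reasoning
  h₀ : ℤ
  h₀ = + 1 ℤ.* f 0 ℤ.* g (suc N)
  P T T′ : ℕ → ℤ
  P k = + (N C k) ℤ.* f (suc k) ℤ.* g (N ∸ k)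
  T k = + (N C suc k) ℤ.* f (suc k) ℤ.* g (N ∸ k)
  T′ k = + (N C suc k) ℤ.* f (suc k) ℤ.* g (suc (N ∸ suc k))
  distrib : ∀ a b x y → (a ℤ.+ b) ℤ.* x ℤ.* y ≡ a ℤ.* x ℤ.* y ℤ.+ b ℤ.* x ℤ.* y
  distrib = solve-∀
  pascal : ∀ k → + (suc N C suc k) ℤ.* f (suc k) ℤ.* g (N ∸ k) ≡ P k ℤ.+ T k
  pascal k rewrite sym (nCk+nC[k+1]≡[n+1]C[k+1] N k) | ℤP.pos-+ (N C k) (N C suc k) =
    distrib (+ (N C k)) (+ (N C suc k)) (f (suc k)) (g (N ∸ k))
  topVanishes : T N ≡ + 0
  topVanishes rewrite k>n⇒nCk≡0 (ℕP.n<1+n N) = refl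
  rearrange : ∀ a b c → a ℤ.+ (b ℤ.+ (c ℤ.+ + 0)) ≡ b ℤ.+ (a ℤ.+ c)
  rearrange = solve-∀
  reindex : ∀ k → k < N → T k ≡ T′ k
  reindex k k<N rewrite sym (ℕP.+-∸-assoc 1 k<N) = refl

cosD-suc : ∀ j → cosD (suc j) ≡ ℤ.- sinD j
sinD-suc : ∀ j → sinD (suc j) ≡ cosD j
cosD-suc zero          = refl
cosD-suc (suc zero)    = refl
cosD-suc (suc (suc j)) = cong ℤ.-_ (cosD-suc j)
sinD-suc zero          = refl
sinD-suc (suc zero)    = refl
sinD-suc (suc (suc j)) = cong ℤ.-_ (sinD-suc j)

conv-cosD∘suc : ∀ (f : ℕ → ℤ) p → conv f (cosD ∘ suc) p ≡ ℤ.- conv f sinD p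
conv-cosD∘suc f p = trans (conv-cong p (λ _ → refl) cosD-suc) (conv-negʳ f sinD p)

conv-sinD∘suc : ∀ (f : ℕ → ℤ) p → conv f (sinD ∘ suc) p ≡ conv f cosD p
conv-sinD∘suc f p = conv-cong p (λ _ → refl) sinD-suc

conv-cosD-suc : ∀ (f : ℕ → ℤ) p → conv f cosD (suc p) ≡ conv (f ∘ suc) cosD p ℤ.- conv f sinD p
conv-cosD-suc f p = trans (conv-leibniz f cosD p) (cong (λ z → conv (f ∘ suc) cosD p ℤ.+ z) (conv-cosD∘suc f p))

conv-sinD-suc : ∀ (f : ℕ → ℤ) p → conv f sinD (suc p) ≡ conv (f ∘ suc) sinD p ℤ.+ conv f cosD p
conv-sinD-suc f p = trans (conv-leibniz f sinD p) (cong (λ z → conv (f ∘ suc) sinD p ℤ.+ z) (conv-sinD∘suc f p))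

shiftFrom : (ℕ → ℕ → ℤ) → ℕ → ℕ → ℤ
shiftFrom X q j = X 0 (j + q)

-- In exponential generating functions along p this is the rotation X + iY ↦ e^{iu}(X + iY) of the initial row.
rotation-closedForm :
  (X Y : ℕ → ℕ → ℤ) →
  (∀ p q → X (suc p) q ≡ X p (suc q) ℤ.- Y p q) →
  (∀ p q → Y (suc p) q ≡ Y p (suc q) ℤ.+ X p q) →
  ∀ p q → (X p q ≡ conv (shiftFrom X q) cosD p ℤ.- conv (shiftFrom Y q) sinD p)
        × (Y p q ≡ conv (shiftFrom X q) sinD p ℤ.+ conv (shiftFrom Y q) cosD p)
rotation-closedForm X Y X-step Y-step zero q =
    trans (atZeroˣ (X 0 q) (Y 0 q)) (sym (cong₂ ℤ._-_ (conv-0 (shiftFrom X q) cosD) (conv-0 (shiftFrom Y q) sinD)))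
  , trans (atZeroʸ (X 0 q) (Y 0 q)) (sym (cong₂ ℤ._+_ (conv-0 (shiftFrom X q) sinD) (conv-0 (shiftFrom Y q) cosD)))
  where
  atZeroˣ : ∀ x y → x ≡ x ℤ.* + 1 ℤ.- y ℤ.* + 0
  atZeroˣ = solve-∀
  atZeroʸ : ∀ x y → y ≡ x ℤ.* + 0 ℤ.+ y ℤ.* + 1
  atZeroʸ = solve-∀
rotation-closedForm X Y X-step Y-step (suc p) q =
    (begin
       X (suc p) q
     ≡⟨ X-step p q ⟩
       X p (suc q) ℤ.- Y p q
     ≡⟨ cong₂ ℤ._-_ (proj₁ (ih (suc q))) (proj₂ (ih q)) ⟩
       (cx′ ℤ.- sy′) ℤ.- (sx ℤ.+ cy)
     ≡⟨ regroupˣ cx′ sy′ sx cy ⟩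
       (cx′ ℤ.- sx) ℤ.- (sy′ ℤ.+ cy)
     ≡⟨ sym (cong₂ ℤ._-_ (trans (conv-cosD-suc x p) (cong (λ z → z ℤ.- sx) (shift X cosD)))
                         (trans (conv-sinD-suc y p) (cong (λ z → z ℤ.+ cy) (shift Y sinD)))) ⟩
       conv x cosD (suc p) ℤ.- conv y sinD (suc p)
     ∎)
  , (begin
       Y (suc p) q
     ≡⟨ Y-step p q ⟩
       Y p (suc q) ℤ.+ X p q
     ≡⟨ cong₂ ℤ._+_ (proj₂ (ih (suc q))) (proj₁ (ih q)) ⟩
       (sx′ ℤ.+ cy′) ℤ.+ (cx ℤ.- sy)
     ≡⟨ regroupʸ sx′ cy′ cx sy ⟩
       (sx′ ℤ.+ cx) ℤ.+ (cy′ ℤ.- sy)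
     ≡⟨ sym (cong₂ ℤ._+_ (trans (conv-sinD-suc x p) (cong (λ z → z ℤ.+ cx) (shift X sinD)))
                         (trans (conv-cosD-suc y p) (cong (λ z → z ℤ.- sy) (shift Y cosD)))) ⟩
       conv x sinD (suc p) ℤ.+ conv y cosD (suc p)
     ∎)
  where
  open ≡-Reasoning
  ih : ∀ q → (X p q ≡ conv (shiftFrom X q) cosD p ℤ.- conv (shiftFrom Y q) sinD p)
           × (Y p q ≡ conv (shiftFrom X q) sinD p ℤ.+ conv (shiftFrom Y q) cosD p)
  ih = rotation-closedForm X Y X-step Y-step p
  x y : ℕ → ℤ
  x = shiftFrom X q
  y = shiftFrom Y q
  cx cx′ sx sx′ cy cy′ sy sy′ : ℤ
  cx  = conv x cosD p
  sx  = conv x sinD p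
  cy  = conv y cosD p
  sy  = conv y sinD p
  cx′ = conv (shiftFrom X (suc q)) cosD p
  sx′ = conv (shiftFrom X (suc q)) sinD p
  cy′ = conv (shiftFrom Y (suc q)) cosD p
  sy′ = conv (shiftFrom Y (suc q)) sinD p
  shift : ∀ (Z : ℕ → ℕ → ℤ) g → conv (shiftFrom Z q ∘ suc) g p ≡ conv (shiftFrom Z (suc q)) g p
  shift Z g = conv-cong {g = g} p (λ j → cong (Z 0) (sym (ℕP.+-suc j q))) (λ _ → refl)
  regroupˣ : ∀ a b c d → (a ℤ.- b) ℤ.- (c ℤ.+ d) ≡ (a ℤ.- c) ℤ.- (b ℤ.+ d)
  regroupˣ = solve-∀
  regroupʸ : ∀ a b c d → (a ℤ.+ b) ℤ.+ (c ℤ.- d) ≡ (a ℤ.+ c) ℤ.+ (b ℤ.- d)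
  regroupʸ = solve-∀

sub-add-cancel : ∀ x y → x ≡ x ℤ.- y ℤ.+ y
sub-add-cancel = solve-∀

add-sub-cancel : ∀ x y → x ≡ x ℤ.+ y ℤ.- y
add-sub-cancel = solve-∀

+-cancelˡ : ∀ a x y → a ℤ.+ x ≡ a ℤ.+ y → x ≡ y
+-cancelˡ a x y eq = trans (undo a x) (trans (cong (λ z → ℤ.- a ℤ.+ z) eq) (sym (undo a y)))
  where
  undo : ∀ a x → x ≡ ℤ.- a ℤ.+ (a ℤ.+ x)
  undo = solve-∀

-- The Entringer array

module EntringerArray (F : ℕ → ℕ → ℤ) (isE : IsEntringer F) where

  Φ : ℕ → ℕ → ℤ
  Φ a b = F (suc (a + b)) (suc a)

  F-1-1 : F 1 1 ≡ + 1
  F-1-1 = let (e , _ , _) = isE in e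

  F-diagonal : ∀ n → 2 ≤ n → F n n ≡ + 0
  F-diagonal = let (_ , e , _) = isE in e

  F-recurrence : ∀ n m → 2 ≤ n → 1 ≤ m → m ≤ n ∸ 1 →
                 F n (suc m) ℤ.- F n m ℤ.+ F (n ∸ 1) (n ∸ m) ≡ + 0
  F-recurrence = let (_ , _ , e) = isE in e

  Φ-boundary : ∀ a → Φ a 0 ≡ δ₀ a
  Φ-boundary zero    = F-1-1
  Φ-boundary (suc a) rewrite ℕP.+-identityʳ a = F-diagonal (suc (suc a)) (s≤s (s≤s z≤n))

  Φ-recurrence : ∀ a b → Φ (suc a) b ≡ Φ a (suc b) ℤ.- Φ b a
  Φ-recurrence a b = solveFor (Φ (suc a) b) (Φ a (suc b)) (Φ b a) recurrence
    where
    n : ℕ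
    n = suc (suc (a + b))
    n∸a : suc (a + b) ∸ a ≡ suc b
    n∸a = trans (cong (_∸ a) (sym (ℕP.+-suc a b))) (ℕP.m+n∸m≡n a (suc b))
    recurrenceAt : F n (suc (suc a)) ℤ.- F n (suc a) ℤ.+ F (n ∸ 1) (n ∸ suc a) ≡ + 0
    recurrenceAt = F-recurrence n (suc a) (s≤s (s≤s z≤n)) (s≤s z≤n) (s≤s (ℕP.m≤m+n a b))
    recurrence : Φ (suc a) b ℤ.- Φ a (suc b) ℤ.+ Φ b a ≡ + 0
    recurrence = trans (cong₂ (λ x y → Φ (suc a) b ℤ.- x ℤ.+ y)
                         (cong (λ z → F (suc z) (suc a)) (ℕP.+-suc a b))
                         (cong (λ z → F (suc z) (suc b)) (ℕP.+-comm b a)))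
                   (trans (cong (λ z → F n (suc (suc a)) ℤ.- F n (suc a) ℤ.+ F (suc (a + b)) z) (sym n∸a)) recurrenceAt)
    solveFor : ∀ x y z → x ℤ.- y ℤ.+ z ≡ + 0 → x ≡ y ℤ.- z
    solveFor x y z eq = trans (shuffle x y z) (trans (cong (λ w → w ℤ.+ (y ℤ.- z)) eq) (ℤP.+-identityˡ (y ℤ.- z)))
      where
      shuffle : ∀ x y z → x ≡ x ℤ.- y ℤ.+ z ℤ.+ (y ℤ.- z)
      shuffle = solve-∀

  Φᵀ : ℕ → ℕ → ℤ
  Φᵀ a b = Φ b a

  Φᵀ-recurrence : ∀ a b → Φᵀ (suc a) b ≡ Φᵀ a (suc b) ℤ.+ Φ a b
  Φᵀ-recurrence a b =
    trans (sub-add-cancel (Φ b (suc a)) (Φ a b)) (cong (λ z → z ℤ.+ Φ a b) (sym (Φ-recurrence b a)))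

  Φ-closedForm : ∀ p q → (Φ p q ≡ conv (shiftFrom Φ q) cosD p ℤ.- conv (shiftFrom Φᵀ q) sinD p)
                       × (Φᵀ p q ≡ conv (shiftFrom Φ q) sinD p ℤ.+ conv (shiftFrom Φᵀ q) cosD p)
  Φ-closedForm = rotation-closedForm Φ Φᵀ Φ-recurrence Φᵀ-recurrence

  firstEntries : ℕ → ℤ
  firstEntries j = Φ 0 j

  firstEntries-tanSec : ∀ N → conv firstEntries cosD N ≡ δ₀ N ℤ.+ sinD N
  firstEntries-tanSec N = begin
      conv firstEntries cosD N
    ≡⟨ conv-cong {g = cosD} N (λ j → cong (Φ 0) (sym (ℕP.+-identityʳ j))) (λ _ → refl) ⟩
      conv (shiftFrom Φ 0) cosD N
    ≡⟨ sub-add-cancel _ (conv (shiftFrom Φᵀ 0) sinD N) ⟩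
      conv (shiftFrom Φ 0) cosD N ℤ.- conv (shiftFrom Φᵀ 0) sinD N ℤ.+ conv (shiftFrom Φᵀ 0) sinD N
    ≡⟨ cong₂ ℤ._+_ (sym (proj₁ (Φ-closedForm N 0))) (conv-δˡ _ sinD N F-1-1 firstColumnVanishes) ⟩
      Φ N 0 ℤ.+ sinD N
    ≡⟨ cong (λ z → z ℤ.+ sinD N) (Φ-boundary N) ⟩
      δ₀ N ℤ.+ sinD N
    ∎
    where
    open ≡-Reasoning
    firstColumnVanishes : ∀ i → shiftFrom Φᵀ 0 (suc i) ≡ + 0
    firstColumnVanishes i = trans (cong (λ z → Φ z 0) (ℕP.+-identityʳ (suc i))) (Φ-boundary (suc i))

  -- Telescoping the recurrence along an anti-diagonal: E_n(1) + … + E_n(t) = E_{n+1}(u+1) for n = u + t.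
  Φ-partialRowSum : ∀ t u → 1 ≤ u + t → Φ u t ≡ Σℤ₁ t (F (u + t))
  Φ-partialRowSum zero    (suc u) _ = Φ-boundary (suc u)
  Φ-partialRowSum (suc t) u _ = begin
      Φ u (suc t)
    ≡⟨ sub-add-cancel (Φ u (suc t)) (Φ t u) ⟩
      Φ u (suc t) ℤ.- Φ t u ℤ.+ Φ t u
    ≡⟨ cong (λ z → z ℤ.+ Φ t u) (sym (Φ-recurrence u t)) ⟩
      Φ (suc u) t ℤ.+ Φ t u
    ≡⟨ cong (λ z → z ℤ.+ Φ t u) (Φ-partialRowSum t (suc u) (s≤s z≤n)) ⟩
      Σℤ₁ t (F (suc (u + t))) ℤ.+ F (suc (t + u)) (suc t)
    ≡⟨ cong (λ z → Σℤ₁ t (F (suc (u + t))) ℤ.+ F (suc z) (suc t)) (ℕP.+-comm t u) ⟩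
      Σℤ₁ t (F (suc (u + t))) ℤ.+ F (suc (u + t)) (suc t)
    ≡⟨ cong (λ z → Σℤ₁ t (F z) ℤ.+ F z (suc t)) (sym (ℕP.+-suc u t)) ⟩
      Σℤ₁ (suc t) (F (u + suc t))
    ∎
    where open ≡-Reasoning

conv-cosD-injective : (E₁ E₂ : ℕ → ℤ) → (∀ N → conv E₁ cosD N ≡ conv E₂ cosD N) → ∀ N → E₁ N ≡ E₂ N
conv-cosD-injective E₁ E₂ same = <-rec (λ N → E₁ N ≡ E₂ N) step
  where
  step : ∀ N → (∀ {j} → j < N → E₁ j ≡ E₂ j) → E₁ N ≡ E₂ N
  step N ih = begin
      E₁ N                                       ≡⟨ sub-add-cancel (E₁ N) (conv E₁ cosD N) ⟩
      E₁ N ℤ.- conv E₁ cosD N ℤ.+ conv E₁ cosD N ≡⟨ cong₂ ℤ._+_ lowerTermsAgree (same N) ⟩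
      E₂ N ℤ.- conv E₂ cosD N ℤ.+ conv E₂ cosD N ≡⟨ sym (sub-add-cancel (E₂ N) (conv E₂ cosD N)) ⟩
      E₂ N                                       ∎
    where
    open ≡-Reasoning
    lowerTermsAgree : E₁ N ℤ.- conv E₁ cosD N ≡ E₂ N ℤ.- conv E₂ cosD N
    lowerTermsAgree = sub-conv-congˡ< E₁ E₂ cosD N refl (λ _ → ih)

entringer-rowSum : (E : ℕ → ℤ) → IsTanSec E → (F : ℕ → ℕ → ℤ) → IsEntringer F →
                   ∀ N → 1 ≤ N → Σℤ₁ N (F N) ≡ E N
entringer-rowSum E tanSec F isE N 1≤N =
  trans (sym (Φ-partialRowSum N 0 1≤N)) (conv-cosD-injective firstEntries E sameConv N)
  where
  open EntringerArray F isE
  sameConv : ∀ M → conv firstEntries cosD M ≡ conv E cosD M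
  sameConv M = trans (firstEntries-tanSec M) (trans (sym (tanSec M)) (Σ₀≡Σ< M _))

cong₃ : ∀ {A B C D : Set} (f : A → B → C → D) {x y u v s t} →
        x ≡ y → u ≡ v → s ≡ t → f x u s ≡ f y v t
cong₃ f refl refl refl = refl

cong₄ : ∀ {A B C D E : Set} (f : A → B → C → D → E) {x y u v s t w z} →
        x ≡ y → u ≡ v → s ≡ t → w ≡ z → f x u s w ≡ f y v t z
cong₄ f refl refl refl refl = refl

conv₁ : (ℕ → ℕ → ℤ) → (ℕ → ℤ) → ℕ → ℕ → ℤ
conv₁ G g a b = conv (λ j → G j b) g a

conv₂ : (ℕ → ℕ → ℤ) → (ℕ → ℤ) → ℕ → ℕ → ℤ
conv₂ G g a b = conv (λ j → G a (suc j)) g b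

conv₁-step : (G ∂G : ℕ → ℕ → ℤ) (g : ℕ → ℤ) → (∀ a b → G (suc a) b ≡ G a (suc b) ℤ.+ ∂G a b) →
             ∀ a b → conv₁ G g (suc a) b ≡ conv₁ G g a (suc b) ℤ.+ conv₁ ∂G g a b ℤ.+ conv₁ G (g ∘ suc) a b
conv₁-step G ∂G g G-step a b =
  trans (conv-leibniz (λ j → G j b) g a)
        (cong (λ z → z ℤ.+ conv₁ G (g ∘ suc) a b)
              (trans (conv-cong {g = g} a (λ j → G-step j b) (λ _ → refl))
                     (conv-+ˡ (λ j → G j (suc b)) (λ j → ∂G j b) g a)))

conv₂-step : (G ∂G : ℕ → ℕ → ℤ) (g : ℕ → ℤ) → (∀ a b → G (suc a) b ≡ G a (suc b) ℤ.+ ∂G a b) →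
             ∀ a b → conv₂ G g (suc a) b ≡ conv₂ G g a (suc b) ℤ.- conv₂ G (g ∘ suc) a b ℤ.+ conv₂ ∂G g a b
conv₂-step G ∂G g G-step a b =
  trans (conv-cong {g = g} b (λ j → G-step a (suc j)) (λ _ → refl))
   (trans (conv-+ˡ (λ j → G a (suc (suc j))) (λ j → ∂G a (suc j)) g b)
    (trans (cong (λ z → z ℤ.+ conv₂ ∂G g a b) (add-sub-cancel (conv (λ j → G a (suc (suc j))) g b) (conv₂ G (g ∘ suc) a b)))
     (cong (λ z → z ℤ.- conv₂ G (g ∘ suc) a b ℤ.+ conv₂ ∂G g a b) (sym (conv-leibniz (λ j → G a (suc j)) g b)))))

δ₀₀ : ℕ → ℕ → ℤ
δ₀₀ zero    b = δ₀ b
δ₀₀ (suc a) b = + 0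

δ₀₀-step : ∀ a b → δ₀₀ (suc a) b ≡ δ₀₀ a (suc b)
δ₀₀-step zero    b = refl
δ₀₀-step (suc a) b = refl

module Defects (F : ℕ → ℕ → ℤ) (isE : IsEntringer F) where
  open EntringerArray F isE

  private
    Φ-step : ∀ a b → Φ (suc a) b ≡ Φ a (suc b) ℤ.+ ℤ.- Φᵀ a b
    Φ-step = Φ-recurrence

  step₁Φ-sin : ∀ a b → conv₁ Φ sinD (suc a) b ≡ conv₁ Φ sinD a (suc b) ℤ.- conv₁ Φᵀ sinD a b ℤ.+ conv₁ Φ cosD a b
  step₁Φ-sin a b = trans (conv₁-step Φ (λ a b → ℤ.- Φᵀ a b) sinD Φ-step a b)
                         (cong₂ (λ x y → conv₁ Φ sinD a (suc b) ℤ.+ x ℤ.+ y)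
                                (conv-negˡ (λ j → Φᵀ j b) sinD a) (conv-sinD∘suc (λ j → Φ j b) a))
  step₁Φ-cos : ∀ a b → conv₁ Φ cosD (suc a) b ≡ conv₁ Φ cosD a (suc b) ℤ.- conv₁ Φᵀ cosD a b ℤ.- conv₁ Φ sinD a b
  step₁Φ-cos a b = trans (conv₁-step Φ (λ a b → ℤ.- Φᵀ a b) cosD Φ-step a b)
                         (cong₂ (λ x y → conv₁ Φ cosD a (suc b) ℤ.+ x ℤ.+ y)
                                (conv-negˡ (λ j → Φᵀ j b) cosD a) (conv-cosD∘suc (λ j → Φ j b) a))
  step₁Φᵀ-sin : ∀ a b → conv₁ Φᵀ sinD (suc a) b ≡ conv₁ Φᵀ sinD a (suc b) ℤ.+ conv₁ Φ sinD a b ℤ.+ conv₁ Φᵀ cosD a b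
  step₁Φᵀ-sin a b = trans (conv₁-step Φᵀ Φ sinD Φᵀ-recurrence a b)
                          (cong (λ y → conv₁ Φᵀ sinD a (suc b) ℤ.+ conv₁ Φ sinD a b ℤ.+ y) (conv-sinD∘suc (λ j → Φᵀ j b) a))
  step₁Φᵀ-cos : ∀ a b → conv₁ Φᵀ cosD (suc a) b ≡ conv₁ Φᵀ cosD a (suc b) ℤ.+ conv₁ Φ cosD a b ℤ.- conv₁ Φᵀ sinD a b
  step₁Φᵀ-cos a b = trans (conv₁-step Φᵀ Φ cosD Φᵀ-recurrence a b)
                          (cong (λ y → conv₁ Φᵀ cosD a (suc b) ℤ.+ conv₁ Φ cosD a b ℤ.+ y) (conv-cosD∘suc (λ j → Φᵀ j b) a))
  step₂Φ-sin : ∀ a b → conv₂ Φ sinD (suc a) b ≡ conv₂ Φ sinD a (suc b) ℤ.- conv₂ Φ cosD a b ℤ.- conv₂ Φᵀ sinD a b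
  step₂Φ-sin a b = trans (conv₂-step Φ (λ a b → ℤ.- Φᵀ a b) sinD Φ-step a b)
                         (cong₂ (λ x y → conv₂ Φ sinD a (suc b) ℤ.- x ℤ.+ y)
                                (conv-sinD∘suc (λ j → Φ a (suc j)) b) (conv-negˡ (λ j → Φᵀ a (suc j)) sinD b))
  step₂Φ-cos : ∀ a b → conv₂ Φ cosD (suc a) b ≡ conv₂ Φ cosD a (suc b) ℤ.- ℤ.- conv₂ Φ sinD a b ℤ.- conv₂ Φᵀ cosD a b
  step₂Φ-cos a b = trans (conv₂-step Φ (λ a b → ℤ.- Φᵀ a b) cosD Φ-step a b)
                         (cong₂ (λ x y → conv₂ Φ cosD a (suc b) ℤ.- x ℤ.+ y)
                                (conv-cosD∘suc (λ j → Φ a (suc j)) b) (conv-negˡ (λ j → Φᵀ a (suc j)) cosD b))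
  step₂Φᵀ-sin : ∀ a b → conv₂ Φᵀ sinD (suc a) b ≡ conv₂ Φᵀ sinD a (suc b) ℤ.- conv₂ Φᵀ cosD a b ℤ.+ conv₂ Φ sinD a b
  step₂Φᵀ-sin a b = trans (conv₂-step Φᵀ Φ sinD Φᵀ-recurrence a b)
                          (cong (λ x → conv₂ Φᵀ sinD a (suc b) ℤ.- x ℤ.+ conv₂ Φ sinD a b) (conv-sinD∘suc (λ j → Φᵀ a (suc j)) b))
  step₂Φᵀ-cos : ∀ a b → conv₂ Φᵀ cosD (suc a) b ≡ conv₂ Φᵀ cosD a (suc b) ℤ.- ℤ.- conv₂ Φᵀ sinD a b ℤ.+ conv₂ Φ cosD a b
  step₂Φᵀ-cos a b = trans (conv₂-step Φᵀ Φ cosD Φᵀ-recurrence a b)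
                          (cong (λ x → conv₂ Φᵀ cosD a (suc b) ℤ.- x ℤ.+ conv₂ Φ cosD a b) (conv-cosD∘suc (λ j → Φᵀ a (suc j)) b))

  -- D₁ and D₂ measure how far the chain decompositions of the column sums of the twin Seidel
  -- matrices are from the Entringer numbers; D₃ and D₄ are the transposed companions needed to
  -- close the recurrence in a.
  D₁ D₂ D₃ D₄ : ℕ → ℕ → ℤ
  D₁ a b = conv₂ Φ sinD a b ℤ.+ conv₁ Φ sinD a b ℤ.- conv₁ Φ cosD a (suc b) ℤ.+ δ₀₀ a b
  D₂ a b = conv₂ Φ cosD a b ℤ.- conv₁ Φ cosD a b ℤ.- conv₁ Φ sinD a (suc b)
  D₃ a b = conv₂ Φᵀ sinD a b ℤ.+ conv₁ Φᵀ sinD a b ℤ.- conv₁ Φᵀ cosD a (suc b)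
  D₄ a b = conv₂ Φᵀ cosD a b ℤ.- conv₁ Φᵀ cosD a b ℤ.- conv₁ Φᵀ sinD a (suc b) ℤ.+ δ₀₀ a b

  D₁-step : ∀ a b → D₁ (suc a) b ≡ D₁ a (suc b) ℤ.- D₂ a b ℤ.- D₃ a b
  D₁-step a b =
    trans (cong₄ (λ w x y z → w ℤ.+ x ℤ.- y ℤ.+ z) (step₂Φ-sin a b) (step₁Φ-sin a b) (step₁Φ-cos a (suc b)) (δ₀₀-step a b))
          (regroup (conv₂ Φ sinD a (suc b)) (conv₂ Φ cosD a b) (conv₂ Φᵀ sinD a b) (conv₁ Φ sinD a (suc b))
                   (conv₁ Φᵀ sinD a b) (conv₁ Φ cosD a b) (conv₁ Φ cosD a (suc (suc b))) (conv₁ Φᵀ cosD a (suc b)) (δ₀₀ a (suc b)))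
    where
    regroup : ∀ a b c d e f g h i →
              (a ℤ.- b ℤ.- c) ℤ.+ (d ℤ.- e ℤ.+ f) ℤ.- (g ℤ.- h ℤ.- d) ℤ.+ i
              ≡ (a ℤ.+ d ℤ.- g ℤ.+ i) ℤ.- (b ℤ.- f ℤ.- d) ℤ.- (c ℤ.+ e ℤ.- h)
    regroup = solve-∀

  D₂-step : ∀ a b → D₂ (suc a) b ≡ D₂ a (suc b) ℤ.+ D₁ a b ℤ.- D₄ a b
  D₂-step a b =
    trans (cong₃ (λ x y z → x ℤ.- y ℤ.- z) (step₂Φ-cos a b) (step₁Φ-cos a b) (step₁Φ-sin a (suc b)))
          (regroup (conv₂ Φ cosD a (suc b)) (conv₂ Φ sinD a b) (conv₂ Φᵀ cosD a b) (conv₁ Φ cosD a (suc b))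
                   (conv₁ Φᵀ cosD a b) (conv₁ Φ sinD a b) (conv₁ Φ sinD a (suc (suc b))) (conv₁ Φᵀ sinD a (suc b)) (δ₀₀ a b))
    where
    regroup : ∀ a b c d e f g h i →
              (a ℤ.- ℤ.- b ℤ.- c) ℤ.- (d ℤ.- e ℤ.- f) ℤ.- (g ℤ.- h ℤ.+ d)
              ≡ (a ℤ.- d ℤ.- g) ℤ.+ (b ℤ.+ f ℤ.- d ℤ.+ i) ℤ.- (c ℤ.- e ℤ.- h ℤ.+ i)
    regroup = solve-∀

  D₃-step : ∀ a b → D₃ (suc a) b ≡ D₃ a (suc b) ℤ.+ D₁ a b ℤ.- D₄ a b
  D₃-step a b =
    trans (cong₃ (λ x y z → x ℤ.+ y ℤ.- z) (step₂Φᵀ-sin a b) (step₁Φᵀ-sin a b) (step₁Φᵀ-cos a (suc b)))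
          (regroup (conv₂ Φᵀ sinD a (suc b)) (conv₂ Φᵀ cosD a b) (conv₂ Φ sinD a b) (conv₁ Φᵀ sinD a (suc b))
                   (conv₁ Φ sinD a b) (conv₁ Φᵀ cosD a b) (conv₁ Φᵀ cosD a (suc (suc b))) (conv₁ Φ cosD a (suc b)) (δ₀₀ a b))
    where
    regroup : ∀ a b c d e f g h i →
              (a ℤ.- b ℤ.+ c) ℤ.+ (d ℤ.+ e ℤ.+ f) ℤ.- (g ℤ.+ h ℤ.- d)
              ≡ (a ℤ.+ d ℤ.- g) ℤ.+ (c ℤ.+ e ℤ.- h ℤ.+ i) ℤ.- (b ℤ.- f ℤ.- d ℤ.+ i)
    regroup = solve-∀

  D₄-step : ∀ a b → D₄ (suc a) b ≡ D₄ a (suc b) ℤ.+ D₂ a b ℤ.+ D₃ a b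
  D₄-step a b =
    trans (cong₄ (λ w x y z → w ℤ.- x ℤ.- y ℤ.+ z) (step₂Φᵀ-cos a b) (step₁Φᵀ-cos a b) (step₁Φᵀ-sin a (suc b)) (δ₀₀-step a b))
          (regroup (conv₂ Φᵀ cosD a (suc b)) (conv₂ Φᵀ sinD a b) (conv₂ Φ cosD a b) (conv₁ Φᵀ cosD a (suc b))
                   (conv₁ Φ cosD a b) (conv₁ Φᵀ sinD a b) (conv₁ Φᵀ sinD a (suc (suc b))) (conv₁ Φ sinD a (suc b)) (δ₀₀ a (suc b)))
    where
    regroup : ∀ a b c d e f g h i →
              (a ℤ.- ℤ.- b ℤ.+ c) ℤ.- (d ℤ.+ e ℤ.- f) ℤ.- (g ℤ.+ h ℤ.+ d) ℤ.+ i
              ≡ (a ℤ.- d ℤ.- g ℤ.+ i) ℤ.+ (c ℤ.- e ℤ.- h) ℤ.+ (b ℤ.+ f ℤ.- d)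
    regroup = solve-∀

  Φ-1 : ∀ b → Φ b 1 ≡ Φ 0 b
  Φ-1 b = trans (sub-add-cancel (Φ b 1) (Φ 0 b))
                (trans (cong (λ z → z ℤ.+ Φ 0 b) (sym (Φ-recurrence b 0)))
                       (trans (cong (λ z → z ℤ.+ Φ 0 b) (Φ-boundary (suc b))) (ℤP.+-identityˡ (Φ 0 b))))

  Φᵀ-shift-vanishes : ∀ j → shiftFrom Φᵀ 1 j ≡ + 0
  Φᵀ-shift-vanishes j = trans (cong (λ z → Φ z 0) (ℕP.+-comm j 1)) (Φ-boundary (suc j))

  conv₂Φ-at0 : ∀ g b → conv₂ Φ g 0 b ≡ conv (shiftFrom Φ 1) g b
  conv₂Φ-at0 g b = conv-cong {g = g} b (λ j → cong (Φ 0) (ℕP.+-comm 1 j)) (λ _ → refl)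

  conv₂Φ-sin-at0 : ∀ b → conv₂ Φ sinD 0 b ≡ Φ 0 (suc b) ℤ.- δ₀ b
  conv₂Φ-sin-at0 b = begin
      conv₂ Φ sinD 0 b
    ≡⟨ conv₂Φ-at0 sinD b ⟩
      conv (shiftFrom Φ 1) sinD b
    ≡⟨ sym (ℤP.+-identityʳ _) ⟩
      conv (shiftFrom Φ 1) sinD b ℤ.+ + 0
    ≡⟨ cong (λ z → conv (shiftFrom Φ 1) sinD b ℤ.+ z) (sym (conv-zeroˡ _ cosD b Φᵀ-shift-vanishes)) ⟩
      conv (shiftFrom Φ 1) sinD b ℤ.+ conv (shiftFrom Φᵀ 1) cosD b
    ≡⟨ sym (proj₂ (Φ-closedForm b 1)) ⟩
      Φ 1 b
    ≡⟨ Φ-recurrence 0 b ⟩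
      Φ 0 (suc b) ℤ.- Φ b 0
    ≡⟨ cong (λ z → Φ 0 (suc b) ℤ.- z) (Φ-boundary b) ⟩
      Φ 0 (suc b) ℤ.- δ₀ b
    ∎
    where open ≡-Reasoning

  conv₂Φ-cos-at0 : ∀ b → conv₂ Φ cosD 0 b ≡ Φ 0 b
  conv₂Φ-cos-at0 b = begin
      conv₂ Φ cosD 0 b
    ≡⟨ conv₂Φ-at0 cosD b ⟩
      conv (shiftFrom Φ 1) cosD b
    ≡⟨ sym (ℤP.+-identityʳ _) ⟩
      conv (shiftFrom Φ 1) cosD b ℤ.+ ℤ.- + 0
    ≡⟨ cong (λ z → conv (shiftFrom Φ 1) cosD b ℤ.- z) (sym (conv-zeroˡ _ sinD b Φᵀ-shift-vanishes)) ⟩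
      conv (shiftFrom Φ 1) cosD b ℤ.- conv (shiftFrom Φᵀ 1) sinD b
    ≡⟨ sym (proj₁ (Φ-closedForm b 1)) ⟩
      Φ b 1
    ≡⟨ Φ-1 b ⟩
      Φ 0 b
    ∎
    where open ≡-Reasoning

  conv₂Φᵀ-at0 : ∀ g b → conv₂ Φᵀ g 0 b ≡ + 0
  conv₂Φᵀ-at0 g b = conv-zeroˡ (λ j → Φᵀ 0 (suc j)) g b (λ j → Φ-boundary (suc j))

  defects-vanish : ∀ a b → (D₁ a b ≡ + 0) × (D₂ a b ≡ + 0) × (D₃ a b ≡ + 0) × (D₄ a b ≡ + 0)
  defects-vanish zero b =
      trans (cong₄ (λ w x y z → w ℤ.+ x ℤ.- y ℤ.+ z) (conv₂Φ-sin-at0 b) (conv-0 (λ j → Φ j b) sinD)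
                   (conv-0 (λ j → Φ j (suc b)) cosD) refl)
            (vanish₁ (Φ 0 (suc b)) (δ₀ b) (Φ 0 b))
    , trans (cong₃ (λ x y z → x ℤ.- y ℤ.- z) (conv₂Φ-cos-at0 b) (conv-0 (λ j → Φ j b) cosD) (conv-0 (λ j → Φ j (suc b)) sinD))
            (vanish₂ (Φ 0 b) (Φ 0 (suc b)))
    , trans (cong₃ (λ x y z → x ℤ.+ y ℤ.- z) (conv₂Φᵀ-at0 sinD b) (conv-0 (λ j → Φᵀ j b) sinD) (conv-0 (λ j → Φᵀ j (suc b)) cosD))
            (trans (vanish₃ (Φᵀ 0 b) (Φ (suc b) 0)) (cong ℤ.-_ (Φ-boundary (suc b))))
    , trans (cong₄ (λ w x y z → w ℤ.- x ℤ.- y ℤ.+ z) (conv₂Φᵀ-at0 cosD b) (conv-0 (λ j → Φᵀ j b) cosD)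
                   (conv-0 (λ j → Φᵀ j (suc b)) sinD) (sym (Φ-boundary b)))
            (vanish₄ (Φᵀ 0 b) (Φᵀ 0 (suc b)))
    where
    vanish₁ : ∀ x d y → (x ℤ.- d) ℤ.+ y ℤ.* + 0 ℤ.- x ℤ.* + 1 ℤ.+ d ≡ + 0
    vanish₁ = solve-∀
    vanish₂ : ∀ x y → x ℤ.- x ℤ.* + 1 ℤ.- y ℤ.* + 0 ≡ + 0
    vanish₂ = solve-∀
    vanish₃ : ∀ x y → + 0 ℤ.+ x ℤ.* + 0 ℤ.- y ℤ.* + 1 ≡ ℤ.- y
    vanish₃ = solve-∀
    vanish₄ : ∀ x y → + 0 ℤ.- x ℤ.* + 1 ℤ.- y ℤ.* + 0 ℤ.+ x ≡ + 0
    vanish₄ = solve-∀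
  defects-vanish (suc a) b with defects-vanish a b | defects-vanish a (suc b)
  ... | (d₁ , d₂ , d₃ , d₄) | (d₁′ , d₂′ , d₃′ , d₄′) =
      trans (D₁-step a b) (cong₃ (λ x y z → x ℤ.- y ℤ.- z) d₁′ d₂ d₃)
    , trans (D₂-step a b) (cong₃ (λ x y z → x ℤ.+ y ℤ.- z) d₂′ d₁ d₄)
    , trans (D₃-step a b) (cong₃ (λ x y z → x ℤ.+ y ℤ.- z) d₃′ d₁ d₄)
    , trans (D₄-step a b) (cong₃ (λ x y z → x ℤ.+ y ℤ.+ z) d₄′ d₂ d₃)

telescope : ∀ (x y : ℕ → ℤ) lo L → (∀ i → i < L → x (lo + i) ≡ x (lo + suc i) ℤ.+ y (lo + i)) →
            x lo ≡ x (lo + L) ℤ.+ Σ< L (λ i → y (lo + i))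
telescope x y lo zero    step = trans (cong x (sym (ℕP.+-identityʳ lo))) (sym (ℤP.+-identityʳ _))
telescope x y lo (suc L) step =
  trans (telescope x y lo L (λ i i<L → step i (ℕP.m<n⇒m<1+n i<L)))
   (trans (cong (λ z → z ℤ.+ Σ< L (λ i → y (lo + i))) (step L (ℕP.n<1+n L)))
          (regroup (x (lo + suc L)) (y (lo + L)) (Σ< L (λ i → y (lo + i)))))
  where
  regroup : ∀ a b c → a ℤ.+ b ℤ.+ c ≡ a ℤ.+ (c ℤ.+ b)
  regroup = solve-∀

-- A hockey-stick identity: the sums telescope by Leibniz' rule.
hockeyStick : ∀ L (f : ℕ → ℤ) →
  (Σ< L (λ p → conv (λ j → f (j + (L ∸ suc p))) cosD p) ≡ conv f sinD L)
  × (Σ< L (λ p → conv (λ j → f (j + (L ∸ suc p))) sinD p) ≡ f L ℤ.- conv f cosD L)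
hockeyStick zero f =
    sym (trans (conv-0 f sinD) (ℤP.*-zeroʳ (f 0)))
  , sym (trans (cong (λ z → f 0 ℤ.- z) (conv-0 f cosD)) (vanish (f 0)))
  where
  vanish : ∀ x → x ℤ.- x ℤ.* + 1 ≡ + 0
  vanish = solve-∀
hockeyStick (suc L) f =
    trans (Σ<-suc L _)
     (trans (cong₂ ℤ._+_ (conv-0 (λ j → f (j + L)) cosD)
                         (trans (Σ<-cong L (λ p → conv-cosD-suc (λ j → f (j + (L ∸ suc p))) p))
                          (trans (Σ<-+ L _ _)
                                 (cong₂ ℤ._+_ (proj₁ (hockeyStick L (f ∘ suc)))
                                              (trans (Σ<-neg L _) (cong ℤ.-_ (proj₂ (hockeyStick L f))))))))
      (trans (regroupᶜ (f L) (conv (f ∘ suc) sinD L) (conv f cosD L)) (sym (conv-sinD-suc f L))))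
  , trans (Σ<-suc L _)
     (trans (cong₂ ℤ._+_ (conv-0 (λ j → f (j + L)) sinD)
                         (trans (Σ<-cong L (λ p → conv-sinD-suc (λ j → f (j + (L ∸ suc p))) p))
                          (trans (Σ<-+ L _ _)
                                 (cong₂ ℤ._+_ (proj₂ (hockeyStick L (f ∘ suc))) (proj₁ (hockeyStick L f))))))
      (trans (regroupˢ (f L) (f (suc L)) (conv (f ∘ suc) cosD L) (conv f sinD L))
             (cong (λ z → f (suc L) ℤ.- z) (sym (conv-cosD-suc f L)))))
  where
  regroupᶜ : ∀ a b c → a ℤ.* + 1 ℤ.+ (b ℤ.+ ℤ.- (a ℤ.- c)) ≡ b ℤ.+ c
  regroupᶜ = solve-∀
  regroupˢ : ∀ a b c d → a ℤ.* + 0 ℤ.+ ((b ℤ.- c) ℤ.+ d) ≡ b ℤ.- (c ℤ.- d)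
  regroupˢ = solve-∀

Σ<-splice : ∀ (D v : ℕ → ℤ) m N → m < N →
            (∀ i → i < m → D i ≡ v i) → (∀ i → m < i → i < N → D (suc i) ≡ v i) →
            Σ< (suc N) D ≡ Σ< N v ℤ.+ D m ℤ.+ D (suc m) ℤ.- v m
Σ<-splice D v m (suc N) (s≤s m≤N) below above with ℕP.m≤n⇒m<n∨m≡n m≤N
... | inj₂ refl =
  trans (cong (λ z → z ℤ.+ D m ℤ.+ D (suc m)) (Σ<-cong< m below)) (regroup (Σ< m v) (v m) (D m) (D (suc m)))
  where
  regroup : ∀ s a x y → s ℤ.+ x ℤ.+ y ≡ s ℤ.+ a ℤ.+ x ℤ.+ y ℤ.- a
  regroup = solve-∀
... | inj₁ m<N =
  trans (cong₂ ℤ._+_ (Σ<-splice D v m N m<N below (λ i m<i i<N → above i m<i (ℕP.m<n⇒m<1+n i<N)))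
                     (above N m<N (ℕP.n<1+n N)))
        (regroup (Σ< N v) (v N) (D m) (D (suc m)) (v m))
  where
  regroup : ∀ s b x y a → s ℤ.+ x ℤ.+ y ℤ.- a ℤ.+ b ≡ s ℤ.+ b ℤ.+ x ℤ.+ y ℤ.- a
  regroup = solve-∀

pos-+-sub-cancel : ∀ x y → + (x + y) ℤ.- + x ≡ + y
pos-+-sub-cancel x y = trans (cong (λ z → z ℤ.- + x) (ℤP.pos-+ x y)) (cancel (+ x) (+ y))
  where
  cancel : ∀ a b → a ℤ.+ b ℤ.- a ≡ b
  cancel = solve-∀

rowSum-difference : ∀ n (f g : ℕ → ℕ) → Σ< n (λ i → + f (suc i) ℤ.- + g (suc i)) ≡ + Σ₁ n f ℤ.- + Σ₁ n g
rowSum-difference n f g =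
  trans (Σ<-+ n _ _) (cong₂ ℤ._+_ (sym (+Σ₁≡Σ< n f)) (trans (Σ<-neg n _) (cong ℤ.-_ (sym (+Σ₁≡Σ< n g)))))

from-difference : ∀ a b c → a ℤ.- b ≡ c ℤ.+ + 0 → a ≡ b ℤ.+ c
from-difference a b c eq =
  trans (split a b) (trans (cong (λ z → b ℤ.+ z) eq) (cong (λ z → b ℤ.+ z) (ℤP.+-identityʳ c)))
  where
  split : ∀ a b → a ≡ b ℤ.+ (a ℤ.- b)
  split = solve-∀

reassoc₄ : ∀ s x y z → s ℤ.+ x ℤ.+ y ℤ.- z ≡ s ℤ.+ (x ℤ.+ y ℤ.- z)
reassoc₄ = solve-∀

-- Twin Seidel matrices

m+1≡suc : ∀ m → m + 1 ≡ suc m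
m+1≡suc m = ℕP.+-comm m 1

+-≡-+ : ∀ {x : ℕ} y z → x ≡ y + z → + x ≡ + y ℤ.+ + z
+-≡-+ y z x≡y+z = trans (cong +_ x≡y+z) (ℤP.pos-+ y z)

module TwinSeidel (A B : Mat) (ts : IsTwinSeidel A B) where

  a-diag : ∀ n m → 2 ≤ n → 1 ≤ m → m ≤ n → ¬ (n ≡ 2 × m ≡ 1) → A n m m ≡ 0
  a-diag = let (p , _) = ts in p

  b-diag : ∀ n m → 2 ≤ n → 1 ≤ m → m ≤ n → B n m m ≡ 0
  b-diag = let (_ , p , _) = ts in p

  lastCol-zero : ∀ n m → 3 ≤ n → 1 ≤ m → m ≤ n → A n m n ≡ 0 × B n m n ≡ 0
  lastCol-zero = let (_ , _ , p , _) = ts in p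

  edgeRow-zero : ∀ n k → 3 ≤ n → 1 ≤ k → k ≤ n → A n n k ≡ 0 × B n 1 k ≡ 0
  edgeRow-zero = let (_ , _ , _ , p , _) = ts in p

  b-corner : ∀ n → 3 ≤ n → B n n 1 ≡ 0
  b-corner = let (_ , _ , _ , _ , p , _) = ts in p

  A₂ : A 2 1 1 ≡ 1 × A 2 1 2 ≡ 0 × A 2 2 1 ≡ 0 × A 2 2 2 ≡ 0
  A₂ = let (_ , _ , _ , _ , _ , p , _) = ts in p

  B₂ : B 2 1 1 ≡ 0 × B 2 1 2 ≡ 0 × B 2 2 1 ≡ 1 × B 2 2 2 ≡ 0
  B₂ = let (_ , _ , _ , _ , _ , _ , p , _) = ts in p

  b-lastRow : ∀ n k → 3 ≤ n → 2 ≤ k → k ≤ n ∸ 1 → B n n k ≡ colSum A (n ∸ 1) (k ∸ 1)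
  b-lastRow = let (_ , _ , _ , _ , _ , _ , _ , p , _) = ts in p

  b-penultRow : ∀ n k → 3 ≤ n → 1 ≤ k → k ≤ n ∸ 2 → B n (n ∸ 1) k ≡ colSum A (n ∸ 1) k
  b-penultRow = let (_ , _ , _ , _ , _ , _ , _ , _ , p , _) = ts in p

  b-step-below : ∀ n m k → 3 ≤ n → 2 ≤ k + 1 → k + 1 ≤ m → m ≤ n ∸ 2 →
                 B n (m + 1) k ≡ B n m k + A (n ∸ 1) m k
  b-step-below = let (_ , _ , _ , _ , _ , _ , _ , _ , _ , p , _) = ts in p

  b-step-above : ∀ n m k → 3 ≤ n → 3 ≤ m + 2 → m + 2 ≤ k → k ≤ n ∸ 1 →
                 B n (m + 1) k ≡ B n m k + A (n ∸ 1) m (k ∸ 1)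
  b-step-above = let (_ , _ , _ , _ , _ , _ , _ , _ , _ , _ , p , _) = ts in p

  a-firstRow : ∀ n k → 3 ≤ n → 2 ≤ k → k ≤ n ∸ 1 → A n 1 k ≡ colSum B (n ∸ 1) (k ∸ 1)
  a-firstRow = let (_ , _ , _ , _ , _ , _ , _ , _ , _ , _ , _ , p , _) = ts in p

  a-step-above : ∀ n m k → 3 ≤ n → 3 ≤ m + 2 → m + 2 ≤ k → k ≤ n ∸ 1 →
                 A n m k ≡ A n (m + 1) k + B (n ∸ 1) m (k ∸ 1)
  a-step-above = let (_ , _ , _ , _ , _ , _ , _ , _ , _ , _ , _ , _ , p , _) = ts in p

  a-step-below : ∀ n m k → 3 ≤ n → 2 ≤ k + 1 → k + 1 ≤ m → m ≤ n ∸ 1 →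
                 A n m k ≡ A n (m + 1) k + B (n ∸ 1) m k
  a-step-below = let (_ , _ , _ , _ , _ , _ , _ , _ , _ , _ , _ , _ , _ , p) = ts in p

  -- Above the diagonal, the entries a_n(p+1, p+q+2) with n = p+q+rr+3 (column rr + 1 before the last)
  -- obey the rotation recurrence in p by (TS4)/(TS5); the first row supplies the initial values.
  module UpperChain (rr : ℕ) where
    level : ℕ → ℕ → ℕ
    level p q = suc (suc (p + q)) + suc rr
    aᵘ bᵘ : ℕ → ℕ → ℤ
    aᵘ p q = + A (level p q) (suc p) (suc (suc (p + q)))
    bᵘ p q = + B (level p q) (suc p) (suc (suc (p + q)))
    α : ℕ → ℤ
    α q = + colSum B (suc q + suc rr) (suc q)

    private
      level-shift : ∀ p q → level p (suc q) ≡ level (suc p) q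
      level-shift p q = cong (λ z → suc (suc z) + suc rr) (ℕP.+-suc p q)
      col-shift : ∀ p q → suc (suc (p + suc q)) ≡ suc (suc (suc (p + q)))
      col-shift p q = cong (λ z → suc (suc z)) (ℕP.+-suc p q)
      3≤level : ∀ p q → 3 ≤ level (suc p) q
      3≤level p q = s≤s (s≤s (s≤s z≤n))
      3≤row+2 : ∀ p → 3 ≤ suc p + 2
      3≤row+2 p = s≤s (ℕP.≤-trans (s≤s (s≤s z≤n)) (ℕP.m≤n+m 2 p))
      row+2≤col : ∀ p q → suc p + 2 ≤ suc (suc (suc (p + q)))
      row+2≤col p q = s≤s (subst (_≤ suc (suc (p + q))) (sym (ℕP.+-comm p 2)) (s≤s (s≤s (ℕP.m≤m+n p q))))
      col≤level-1 : ∀ p q → suc (suc (suc (p + q))) ≤ level (suc p) q ∸ 1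
      col≤level-1 p q = s≤s (s≤s (subst (suc (p + q) ≤_) (sym (ℕP.+-suc (p + q) rr)) (s≤s (ℕP.m≤m+n (p + q) rr))))

    aᵘ-step : ∀ p q → aᵘ (suc p) q ≡ aᵘ p (suc q) ℤ.- bᵘ p q
    aᵘ-step p q =
      trans (add-sub-cancel (aᵘ (suc p) q) (bᵘ p q))
            (cong (λ z → z ℤ.- bᵘ p q)
                  (sym (+-≡-+ (A (level (suc p) q) (suc (suc p)) (suc (suc (suc (p + q))))) (B (level p q) (suc p) (suc (suc (p + q)))) eq)))
      where
      eq : A (level p (suc q)) (suc p) (suc (suc (p + suc q))) ≡ A (level (suc p) q) (suc (suc p)) (suc (suc (suc (p + q)))) + B (level p q) (suc p) (suc (suc (p + q)))
      eq = trans (cong₃ A (level-shift p q) refl (col-shift p q))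
            (trans (a-step-above (level (suc p) q) (suc p) (suc (suc (suc (p + q)))) (3≤level p q) (3≤row+2 p) (row+2≤col p q) (col≤level-1 p q))
                   (cong (λ z → z + B (level p q) (suc p) (suc (suc (p + q)))) (cong₃ A refl (m+1≡suc (suc p)) refl)))

    bᵘ-step : ∀ p q → bᵘ (suc p) q ≡ bᵘ p (suc q) ℤ.+ aᵘ p q
    bᵘ-step p q = +-≡-+ (B (level p (suc q)) (suc p) (suc (suc (p + suc q)))) (A (level p q) (suc p) (suc (suc (p + q)))) eq
      where
      eq : B (level (suc p) q) (suc (suc p)) (suc (suc (suc (p + q)))) ≡ B (level p (suc q)) (suc p) (suc (suc (p + suc q))) + A (level p q) (suc p) (suc (suc (p + q)))
      eq = trans (cong₃ B refl (sym (m+1≡suc (suc p))) refl)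
            (trans (b-step-above (level (suc p) q) (suc p) (suc (suc (suc (p + q)))) (3≤level p q) (3≤row+2 p) (row+2≤col p q) (col≤level-1 p q))
                   (cong (λ z → z + A (level p q) (suc p) (suc (suc (p + q)))) (sym (cong₃ B (level-shift p q) refl (col-shift p q)))))

    3≤level₀ : ∀ q → 3 ≤ level 0 q
    3≤level₀ q = s≤s (s≤s (subst (1 ≤_) (sym (ℕP.+-suc q rr)) (s≤s z≤n)))

    aᵘ-initial : ∀ q → aᵘ 0 q ≡ α q
    aᵘ-initial q = cong +_ (a-firstRow (level 0 q) (suc (suc q)) (3≤level₀ q) (s≤s (s≤s z≤n))
                       (s≤s (subst (suc q ≤_) (sym (ℕP.+-suc q rr)) (s≤s (ℕP.m≤m+n q rr)))))

    bᵘ-initial : ∀ q → bᵘ 0 q ≡ + 0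
    bᵘ-initial q = cong +_ (proj₂ (edgeRow-zero (level 0 q) (suc (suc q)) (3≤level₀ q) (s≤s z≤n)
                       (s≤s (s≤s (ℕP.m≤m+n q (suc rr))))))

    upper-closedForm : ∀ p q → (aᵘ p q ≡ conv (λ j → α (j + q)) cosD p) × (bᵘ p q ≡ conv (λ j → α (j + q)) sinD p)
    upper-closedForm p q =
        trans (proj₁ (rotation-closedForm aᵘ bᵘ aᵘ-step bᵘ-step p q)) (trans (cong₂ ℤ._-_ (conv-cong {g = cosD} p (λ j → aᵘ-initial (j + q)) (λ _ → refl))
                                              (conv-zeroˡ _ sinD p (λ j → bᵘ-initial (j + q)))) (ℤP.+-identityʳ _))
      , trans (proj₂ (rotation-closedForm aᵘ bᵘ aᵘ-step bᵘ-step p q)) (trans (cong₂ ℤ._+_ (conv-cong {g = sinD} p (λ j → aᵘ-initial (j + q)) (λ _ → refl))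
                                              (conv-zeroˡ _ cosD p (λ j → bᵘ-initial (j + q)))) (ℤP.+-identityʳ _))

  -- Below the diagonal, the entries a_n(q+kk+2, kk+1) with n = p+q+kk+3 (row p + 1 above the last)
  -- obey the same recurrence; the penultimate row, fed by the last row of B and the column sums
  -- of A one level down, supplies the initial values.
  module LowerChain (kk : ℕ) where
    level : ℕ → ℕ → ℕ
    level p q = suc (suc (p + q + suc kk))
    row : ℕ → ℕ
    row q = suc (q + suc kk)
    aˡ bˡ : ℕ → ℕ → ℤ
    aˡ p q = + A (level p q) (row q) (suc kk)
    bˡ p q = + B (level p q) (row q) (suc kk)
    γ ρ : ℕ → ℤ
    γ q = + B (row q) (row q) (suc kk)
    ρ q = + colSum A (row q) (suc kk)

    private
      level-shift : ∀ p q → level (suc p) q ≡ level p (suc q)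
      level-shift p q = cong (λ z → suc (suc (z + suc kk))) (sym (ℕP.+-suc p q))
      2≤col+1 : 2 ≤ suc kk + 1
      2≤col+1 = s≤s (subst (1 ≤_) (sym (m+1≡suc kk)) (s≤s z≤n))
      col+1≤row : ∀ q → suc kk + 1 ≤ row q
      col+1≤row q = s≤s (subst (_≤ q + suc kk) (sym (m+1≡suc kk)) (ℕP.m≤n+m (suc kk) q))
      row≤level-rows : ∀ p q → q + suc kk ≤ p + q + suc kk
      row≤level-rows p q = ℕP.+-monoˡ-≤ (suc kk) (ℕP.m≤n+m q p)
      row≤level-1 : ∀ p q → row q ≤ level (suc p) q ∸ 1
      row≤level-1 p q = s≤s (ℕP.≤-trans (row≤level-rows p q) (ℕP.n≤1+n _))
      row≤level-2 : ∀ p q → row q ≤ level (suc p) q ∸ 2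
      row≤level-2 p q = s≤s (row≤level-rows p q)
      3≤level : ∀ p q → 3 ≤ level (suc p) q
      3≤level p q = s≤s (s≤s (s≤s z≤n))
      3≤level₀ : ∀ q → 3 ≤ level 0 q
      3≤level₀ q = s≤s (s≤s (subst (1 ≤_) (sym (ℕP.+-suc q kk)) (s≤s z≤n)))

    aˡ-step : ∀ p q → aˡ (suc p) q ≡ aˡ p (suc q) ℤ.- ℤ.- bˡ p q
    aˡ-step p q = trans (+-≡-+ (A (level p (suc q)) (row (suc q)) (suc kk)) (B (level p q) (row q) (suc kk)) eq) (sub-neg (aˡ p (suc q)) (bˡ p q))
      where
      eq : A (level (suc p) q) (row q) (suc kk) ≡ A (level p (suc q)) (row (suc q)) (suc kk) + B (level p q) (row q) (suc kk)
      eq = trans (a-step-below (level (suc p) q) (row q) (suc kk) (3≤level p q) 2≤col+1 (col+1≤row q) (row≤level-1 p q))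
                 (cong (λ z → z + B (level p q) (row q) (suc kk)) (cong₃ A (level-shift p q) (m+1≡suc (row q)) refl))
      sub-neg : ∀ x y → x ℤ.+ y ≡ x ℤ.- ℤ.- y
      sub-neg = solve-∀

    bˡ-step : ∀ p q → ℤ.- bˡ (suc p) q ≡ ℤ.- bˡ p (suc q) ℤ.+ aˡ p q
    bˡ-step p q =
      trans (neg-split (bˡ (suc p) q) (aˡ p q))
            (cong (λ z → ℤ.- z ℤ.+ aˡ p q) (sym (+-≡-+ (B (level (suc p) q) (row q) (suc kk)) (A (level p q) (row q) (suc kk)) eq)))
      where
      eq : B (level p (suc q)) (row (suc q)) (suc kk) ≡ B (level (suc p) q) (row q) (suc kk) + A (level p q) (row q) (suc kk)
      eq = trans (cong₃ B (sym (level-shift p q)) (sym (m+1≡suc (row q))) refl)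
                 (b-step-below (level (suc p) q) (row q) (suc kk) (3≤level p q) 2≤col+1 (col+1≤row q) (row≤level-2 p q))
      neg-split : ∀ x y → ℤ.- x ≡ ℤ.- (x ℤ.+ y) ℤ.+ y
      neg-split = solve-∀

    aˡ-initial : ∀ q → aˡ 0 q ≡ γ q
    aˡ-initial q = cong +_ (trans (a-step-below (level 0 q) (row q) (suc kk) (3≤level₀ q) 2≤col+1 (col+1≤row q) ℕP.≤-refl)
                          (cong (λ z → z + B (row q) (row q) (suc kk))
                                (trans (cong₃ A refl (m+1≡suc (row q)) refl)
                                       (proj₁ (edgeRow-zero (level 0 q) (suc kk) (3≤level₀ q) (s≤s z≤n)
                                           (ℕP.≤-trans (ℕP.m≤n+m (suc kk) q) (ℕP.≤-trans (ℕP.n≤1+n _) (ℕP.n≤1+n _))))))))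

    bˡ-initial : ∀ q → ℤ.- bˡ 0 q ≡ ℤ.- ρ q
    bˡ-initial q = cong (λ z → ℤ.- (+ z)) (b-penultRow (level 0 q) (suc kk) (3≤level₀ q) (s≤s z≤n) (ℕP.m≤n+m (suc kk) q))

    lower-closedForm : ∀ p q → (aˡ p q ≡ conv (λ j → γ (j + q)) cosD p ℤ.+ conv (λ j → ρ (j + q)) sinD p)
                  × (bˡ p q ≡ ℤ.- conv (λ j → γ (j + q)) sinD p ℤ.+ conv (λ j → ρ (j + q)) cosD p)
    lower-closedForm p q =
        trans (proj₁ (rotation-closedForm aˡ (λ p q → ℤ.- bˡ p q) aˡ-step bˡ-step p q)) (trans (cong₂ ℤ._-_ (conv-cong {g = cosD} p (λ j → aˡ-initial (j + q)) (λ _ → refl))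
                                              (trans (conv-cong {g = sinD} p (λ j → bˡ-initial (j + q)) (λ _ → refl))
                                                     (conv-negˡ (λ j → ρ (j + q)) sinD p)))
                                (sub-neg (conv (λ j → γ (j + q)) cosD p) (conv (λ j → ρ (j + q)) sinD p)))
      , trans (sym (ℤP.neg-involutive (bˡ p q))) (trans (cong ℤ.-_ (proj₂ (rotation-closedForm aˡ (λ p q → ℤ.- bˡ p q) aˡ-step bˡ-step p q)))
           (trans (cong (λ z → ℤ.- z) (cong₂ ℤ._+_ (conv-cong {g = sinD} p (λ j → aˡ-initial (j + q)) (λ _ → refl))
                                              (trans (conv-cong {g = cosD} p (λ j → bˡ-initial (j + q)) (λ _ → refl))
                                                     (conv-negˡ (λ j → ρ (j + q)) cosD p))))
                  (neg-distrib (conv (λ j → γ (j + q)) sinD p) (conv (λ j → ρ (j + q)) cosD p))))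
      where
      sub-neg : ∀ x y → x ℤ.- ℤ.- y ≡ x ℤ.+ y
      sub-neg = solve-∀
      neg-distrib : ∀ x y → ℤ.- (x ℤ.+ ℤ.- y) ≡ ℤ.- x ℤ.+ y
      neg-distrib = solve-∀

  +-suc-comm : ∀ a b → a + suc b ≡ b + suc a
  +-suc-comm a b = trans (ℕP.+-suc a b) (trans (cong suc (ℕP.+-comm a b)) (sym (ℕP.+-suc b a)))

  colSum-split : ∀ (M : Mat) kk rr →
    + colSum M (suc kk + suc rr) (suc kk) ≡
      Σ< kk (λ p → + M (suc kk + suc rr) (suc p) (suc kk)) ℤ.+
      ((+ M (suc kk + suc rr) (suc kk) (suc kk) ℤ.+ Σ< rr (λ i → + M (suc kk + suc rr) (suc (i + suc kk)) (suc kk))) ℤ.+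
        + M (suc kk + suc rr) (suc kk + suc rr) (suc kk))
  colSum-split M kk rr =
    trans (+Σ₁≡Σ< n (λ m → M n m k))
     (trans (cong (λ z → Σ< z f) (sym (ℕP.+-suc kk (suc rr))))
      (trans (Σ<-+-split kk (suc (suc rr)) f)
       (cong (λ z → Σ< kk f ℤ.+ z)
        (cong (λ z → z ℤ.+ + M n n k)
         (trans (Σ<-suc rr (λ i → f (kk + i)))
          (cong₂ ℤ._+_ (cong (λ z → + M n (suc z) k) (ℕP.+-identityʳ kk))
                       (Σ<-cong rr (λ i → cong (λ z → + M n (suc z) k) (+-suc-comm kk i)))))))))
    where
    n k : ℕ
    n = suc kk + suc rr
    k = suc kk
    f : ℕ → ℤ
    f i = + M n (suc i) k

  module ColumnSums (kk rr : ℕ) (3≤n : 3 ≤ suc kk + suc rr) where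
    open UpperChain rr using (aᵘ; bᵘ; α; upper-closedForm)
    open LowerChain kk using (aˡ; bˡ; γ; ρ; lower-closedForm)
    n k : ℕ
    n = suc kk + suc rr
    k = suc kk

    upperEntries-chain : ∀ (M : Mat) (X : ℕ → ℕ → ℤ) → (∀ p q → X p q ≡ + M (suc (suc (p + q)) + suc rr) (suc p) (suc (suc (p + q)))) →
          Σ< kk (λ p → + M n (suc p) k) ≡ Σ< kk (λ p → X p (kk ∸ suc p))
    upperEntries-chain M X hX = Σ<-cong< kk (λ p p<kk → sym (trans (hX p (kk ∸ suc p))
                   (cong (λ z → + M (suc z + suc rr) (suc p) (suc z)) (ℕP.m+[n∸m]≡n p<kk))))

    lowerEntries-chain : ∀ (M : Mat) (X : ℕ → ℕ → ℤ) → (∀ p q → X p q ≡ + M (suc (suc (p + q + suc kk))) (suc (q + suc kk)) (suc kk)) →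
          Σ< rr (λ i → + M n (suc (i + suc kk)) k) ≡ Σ< rr (λ p → X p (rr ∸ suc p))
    lowerEntries-chain M X hX = trans (Σ<-cong< rr (λ i i<rr → sym (trans (hX (rr ∸ suc i) i)
                            (cong (λ z → + M z (suc (i + suc kk)) k) (level≡n i i<rr)))))
                        (trans (Σ<-cong< rr (λ i i<rr → cong (X (rr ∸ suc i)) (sym (reverse-index i i<rr))))
                               (Σ<-reverse rr (λ p → X p (rr ∸ suc p))))
      where
      reverse-index : ∀ i → i < rr → rr ∸ suc (rr ∸ suc i) ≡ i
      reverse-index i h = trans (cong (λ z → z ∸ suc (rr ∸ suc i)) (sym (ℕP.m+[n∸m]≡n h))) (ℕP.m+n∸n≡m i (rr ∸ suc i))
      level≡n : ∀ i → i < rr → suc (suc (rr ∸ suc i + i + suc kk)) ≡ n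
      level≡n i i<rr = cong suc (trans (cong (λ z → suc (z + suc kk)) (trans (ℕP.+-comm (rr ∸ suc i) i) refl))
                                (trans (cong (λ z → z + suc kk) (ℕP.m+[n∸m]≡n i<rr)) (+-suc-comm rr kk)))

    diagA : + A n k k ≡ + 0
    diagA = cong +_ (a-diag n k (ℕP.≤-trans (s≤s (s≤s z≤n)) 3≤n) (s≤s z≤n) (s≤s (ℕP.m≤m+n kk (suc rr)))
                        (λ { (e , _) → ℕP.<-irrefl (sym e) 3≤n }))
    lastA : + A n n k ≡ + 0
    lastA = cong +_ (proj₁ (edgeRow-zero n k 3≤n (s≤s z≤n) (s≤s (ℕP.m≤m+n kk (suc rr)))))
    diagB : + B n k k ≡ + 0
    diagB = cong +_ (b-diag n k (ℕP.≤-trans (s≤s (s≤s z≤n)) 3≤n) (s≤s z≤n) (s≤s (ℕP.m≤m+n kk (suc rr))))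
    lastB : + B n n k ≡ γ rr
    lastB = cong +_ (cong₃ B n≡row n≡row refl)
      where
      n≡row : n ≡ suc (rr + suc kk)
      n≡row = cong suc (+-suc-comm kk rr)

    colA-formula : + colSum A n k ≡ conv α sinD kk ℤ.+ (conv γ sinD rr ℤ.+ (ρ rr ℤ.- conv ρ cosD rr))
    colA-formula =
      trans (colSum-split A kk rr)
       (trans (cong₂ ℤ._+_ (trans (upperEntries-chain A aᵘ (λ _ _ → refl)) (trans (Σ<-cong kk (λ p → proj₁ (upper-closedForm p (kk ∸ suc p)))) (proj₁ (hockeyStick kk α))))
                            (cong₂ ℤ._+_ (cong₂ ℤ._+_ diagA (trans (lowerEntries-chain A aˡ (λ _ _ → refl))
                                          (trans (Σ<-cong rr (λ p → proj₁ (lower-closedForm p (rr ∸ suc p))))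
                                           (trans (Σ<-+ rr _ _) (cong₂ ℤ._+_ (proj₁ (hockeyStick rr γ)) (proj₂ (hockeyStick rr ρ)))))))
                                         lastA))
              (regroup (conv α sinD kk) (conv γ sinD rr) (ρ rr) (conv ρ cosD rr)))
      where
      regroup : ∀ a b c d → a ℤ.+ ((+ 0 ℤ.+ (b ℤ.+ (c ℤ.- d))) ℤ.+ + 0) ≡ a ℤ.+ (b ℤ.+ (c ℤ.- d))
      regroup = solve-∀

    colB-formula : + colSum B n k ≡ (α kk ℤ.- conv α cosD kk) ℤ.+ (conv γ cosD rr ℤ.+ conv ρ sinD rr)
    colB-formula =
      trans (colSum-split B kk rr)
       (trans (cong₂ ℤ._+_ (trans (upperEntries-chain B bᵘ (λ _ _ → refl)) (trans (Σ<-cong kk (λ p → proj₂ (upper-closedForm p (kk ∸ suc p)))) (proj₂ (hockeyStick kk α))))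
                            (cong₂ ℤ._+_ (cong₂ ℤ._+_ diagB (trans (lowerEntries-chain B bˡ (λ _ _ → refl))
                                          (trans (Σ<-cong rr (λ p → proj₂ (lower-closedForm p (rr ∸ suc p))))
                                           (trans (Σ<-+ rr _ _) (cong₂ ℤ._+_ (trans (Σ<-neg rr _) (cong ℤ.-_ (proj₂ (hockeyStick rr γ)))) (proj₁ (hockeyStick rr ρ)))))))
                                         lastB))
              (regroup (α kk ℤ.- conv α cosD kk) (γ rr) (conv γ cosD rr) (ρ rr) (conv ρ sinD rr)))
      where
      regroup : ∀ a g c r s → a ℤ.+ ((+ 0 ℤ.+ (ℤ.- (g ℤ.- c) ℤ.+ s)) ℤ.+ g) ≡ a ℤ.+ (c ℤ.+ s)
      regroup = solve-∀

  -- (TS2) only speaks about n ≥ 3; at n = 2 the same vanishing is read off (TS3).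
  lastRowA-zero : ∀ N k → 2 ≤ N → 1 ≤ k → k ≤ N → A N N k ≡ 0
  lastRowA-zero 0 _ () _ _
  lastRowA-zero 1 _ (s≤s ()) _ _
  lastRowA-zero 2 1 _ _ _ = proj₁ (proj₂ (proj₂ A₂))
  lastRowA-zero 2 2 _ _ _ = proj₂ (proj₂ (proj₂ A₂))
  lastRowA-zero 2 (suc (suc (suc k))) _ _ (s≤s (s≤s ()))
  lastRowA-zero N@(suc (suc (suc _))) k _ 1≤k k≤N = proj₁ (edgeRow-zero N k (s≤s (s≤s (s≤s z≤n))) 1≤k k≤N)

  lastColA-zero : ∀ N m → 2 ≤ N → 1 ≤ m → m ≤ N → A N m N ≡ 0
  lastColA-zero 0 _ () _ _
  lastColA-zero 1 _ (s≤s ()) _ _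
  lastColA-zero 2 1 _ _ _ = proj₁ (proj₂ A₂)
  lastColA-zero 2 2 _ _ _ = proj₂ (proj₂ (proj₂ A₂))
  lastColA-zero 2 (suc (suc (suc m))) _ _ (s≤s (s≤s ()))
  lastColA-zero N@(suc (suc (suc _))) m _ 1≤m m≤N = proj₁ (lastCol-zero N m (s≤s (s≤s (s≤s z≤n))) 1≤m m≤N)

  lastColB-zero : ∀ N m → 2 ≤ N → 1 ≤ m → m ≤ N → B N m N ≡ 0
  lastColB-zero 0 _ () _ _
  lastColB-zero 1 _ (s≤s ()) _ _
  lastColB-zero 2 1 _ _ _ = proj₁ (proj₂ B₂)
  lastColB-zero 2 2 _ _ _ = proj₂ (proj₂ (proj₂ B₂))
  lastColB-zero 2 (suc (suc (suc m))) _ _ (s≤s (s≤s ()))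
  lastColB-zero N@(suc (suc (suc _))) m _ 1≤m m≤N = proj₂ (lastCol-zero N m (s≤s (s≤s (s≤s z≤n))) 1≤m m≤N)

  -- Telescoping column m + 1 of A_n down from the first row and column m up from the last row
  -- splits the same column of B_{n-1} at the diagonal (dually for B_n and A_{n-1}).
  module NearDiagonal (m' d : ℕ) where
    m N n : ℕ
    m = suc m'
    N = suc (suc (m' + d))
    n = suc N

    3≤n : 3 ≤ n
    3≤n = s≤s (s≤s (s≤s z≤n))
    2≤m+1 : 2 ≤ m + 1
    2≤m+1 = s≤s (subst (1 ≤_) (sym (m+1≡suc m')) (s≤s z≤n))
    m<N : suc m ≤ N
    m<N = s≤s (s≤s (ℕP.m≤m+n m' d))
    3≤i+2 : ∀ i → 3 ≤ suc i + 2
    3≤i+2 i = s≤s (subst (2 ≤_) (sym (ℕP.+-comm i 2)) (s≤s (s≤s z≤n)))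
    i+2≤m+1 : ∀ i → i < m' → suc i + 2 ≤ suc m
    i+2≤m+1 i h = s≤s (subst (_≤ suc m') (sym (ℕP.+-comm i 2)) (s≤s h))
    m+1≤row : ∀ i → m + 1 ≤ suc m + i
    m+1≤row i = subst (_≤ suc m + i) (sym (m+1≡suc m)) (ℕP.m≤m+n (suc m) i)
    +-suc-assoc : ∀ lo i → lo + i + 1 ≡ lo + suc i
    +-suc-assoc lo i = trans (ℕP.+-assoc lo i 1) (cong (λ z → lo + z) (m+1≡suc i))

    a-nearDiagonal : + A n m (suc m) ≡ + A n (suc m) m
    a-nearDiagonal = +-cancelˡ Σabove _ _ (begin
        Σabove ℤ.+ + A n m (suc m)  ≡⟨ ℤP.+-comm Σabove _ ⟩
        + A n m (suc m) ℤ.+ Σabove  ≡⟨ sym down-from-first ⟩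
        + A n 1 (suc m)             ≡⟨ firstRow-split ⟩
        Σabove ℤ.+ Σbelow           ≡⟨ cong (λ z → Σabove ℤ.+ z) (sym up-from-last′) ⟩
        Σabove ℤ.+ + A n (suc m) m  ∎)
      where
      open ≡-Reasoning
      Σabove Σbelow : ℤ
      Σabove = Σ< m' (λ i → + B N (1 + i) m)
      Σbelow = Σ< (suc d) (λ i → + B N (suc m + i) m)
      down-from-first : + A n 1 (suc m) ≡ + A n m (suc m) ℤ.+ Σabove
      down-from-first = telescope (λ i → + A n i (suc m)) (λ i → + B N i m) 1 m'
              (λ i h → +-≡-+ (A n (suc (suc i)) (suc m)) (B N (suc i) m)
                         (trans (a-step-above n (suc i) (suc m) 3≤n (3≤i+2 i) (i+2≤m+1 i h) m<N)
                                (cong (λ z → z + B N (suc i) m) (cong₃ A refl (m+1≡suc (suc i)) refl))))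
      up-from-last : + A n (suc m) m ≡ + A n (suc m + suc d) m ℤ.+ Σbelow
      up-from-last = telescope (λ i → + A n i m) (λ i → + B N i m) (suc m) (suc d)
              (λ i h → +-≡-+ (A n (suc m + suc i) m) (B N (suc m + i) m)
                         (trans (a-step-below n (suc m + i) m 3≤n 2≤m+1 (m+1≤row i) (s≤s (s≤s (ℕP.+-monoʳ-≤ m' (ℕP.≤-pred h)))))
                                (cong (λ z → z + B N (suc m + i) m) (cong₃ A refl (+-suc-assoc (suc m) i) refl))))
      up-from-last′ : + A n (suc m) m ≡ Σbelow
      up-from-last′ = trans up-from-last (trans (cong (λ z → z ℤ.+ Σbelow)
                 (cong +_ (trans (cong₃ A refl (cong (λ z → suc (suc z)) (ℕP.+-suc m' d)) refl)
                                 (proj₁ (edgeRow-zero n m 3≤n (s≤s z≤n) (s≤s (ℕP.≤-trans (ℕP.m≤m+n m' d) (ℕP.≤-trans (ℕP.n≤1+n _) (ℕP.n≤1+n _)))))))))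
                 (ℤP.+-identityˡ Σbelow))
      firstRow-split : + A n 1 (suc m) ≡ Σabove ℤ.+ Σbelow
      firstRow-split = trans (cong +_ (a-firstRow n (suc m) 3≤n (s≤s (s≤s z≤n)) m<N))
              (trans (+Σ₁≡Σ< N (λ i → B N i m))
               (trans (cong (λ z → Σ< z (λ i → + B N (suc i) m)) (sym (trans (ℕP.+-suc m' (suc d)) (cong suc (ℕP.+-suc m' d)))))
                (trans (Σ<-+-split m' (suc (suc d)) (λ i → + B N (suc i) m))
                 (cong (λ z → Σabove ℤ.+ z)
                  (trans (Σ<-suc (suc d) _)
                   (trans (cong₂ ℤ._+_ (cong +_ (trans (cong₃ B refl (cong suc (ℕP.+-identityʳ m')) refl) (b-diag N m (s≤s (s≤s z≤n)) (s≤s z≤n) (ℕP.≤-trans (ℕP.n≤1+n m) m<N))))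
                                       (Σ<-cong (suc d) (λ i → cong (λ z → + B N (suc z) m) (ℕP.+-suc m' i))))
                          (ℤP.+-identityˡ Σbelow)))))))

    b-nearDiagonal : + B n (suc m) m ≡ + B n m (suc m) ℤ.+ + A N m m
    b-nearDiagonal = begin
        + B n (suc m) m                                          ≡⟨ b-below ⟩
        + colSum A N m ℤ.- Σbelow                                ≡⟨ cong (λ z → z ℤ.- Σbelow) colSum-split′ ⟩
        Σabove ℤ.+ (+ A N m m ℤ.+ (Σbelow ℤ.+ + 0)) ℤ.- Σbelow   ≡⟨ regroup Σabove (+ A N m m) Σbelow ⟩
        Σabove ℤ.+ + A N m m                                     ≡⟨ cong (λ z → z ℤ.+ + A N m m) (sym b-above) ⟩
        + B n m (suc m) ℤ.+ + A N m m                            ∎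
      where
      open ≡-Reasoning
      Σabove Σbelow : ℤ
      Σabove = Σ< m' (λ i → + A N (1 + i) m)
      Σbelow = Σ< d (λ i → + A N (suc m + i) m)
      neg-split : ∀ x y → ℤ.- x ≡ ℤ.- (x ℤ.+ y) ℤ.+ y
      neg-split = solve-∀
      down-from-first : ℤ.- + B n 1 (suc m) ≡ ℤ.- + B n m (suc m) ℤ.+ Σabove
      down-from-first = telescope (λ i → ℤ.- + B n i (suc m)) (λ i → + A N i m) 1 m'
              (λ i h → trans (neg-split (+ B n (suc i) (suc m)) (+ A N (suc i) m))
                         (cong (λ z → ℤ.- z ℤ.+ + A N (suc i) m)
                           (sym (+-≡-+ (B n (suc i) (suc m)) (A N (suc i) m)
                              (trans (cong₃ B refl (sym (m+1≡suc (suc i))) refl) (b-step-above n (suc i) (suc m) 3≤n (3≤i+2 i) (i+2≤m+1 i h) m<N))))))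
      up-from-last : ℤ.- + B n (suc m) m ≡ ℤ.- + B n N m ℤ.+ Σbelow
      up-from-last = telescope (λ i → ℤ.- + B n i m) (λ i → + A N i m) (suc m) d
              (λ i h → trans (neg-split (+ B n (suc m + i) m) (+ A N (suc m + i) m))
                         (cong (λ z → ℤ.- z ℤ.+ + A N (suc m + i) m)
                           (sym (+-≡-+ (B n (suc m + i) m) (A N (suc m + i) m)
                              (trans (cong₃ B refl (sym (+-suc-assoc (suc m) i)) refl)
                                (b-step-below n (suc m + i) m 3≤n 2≤m+1 (m+1≤row i) (s≤s (subst (_≤ m' + d) (ℕP.+-suc m' i) (ℕP.+-monoʳ-≤ m' h)))))))))
      b-above : + B n m (suc m) ≡ Σabove
      b-above = cancel-first (+ B n m (suc m)) Σabove
                  (trans (sym (cong (λ z → ℤ.- + z) (proj₂ (edgeRow-zero n (suc m) 3≤n (s≤s z≤n) (s≤s (ℕP.≤-trans (ℕP.n≤1+n m) m<N))))))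
                         down-from-first)
        where
        cancel-first : ∀ b u → + 0 ≡ ℤ.- b ℤ.+ u → b ≡ u
        cancel-first b u h = trans (sym (ℤP.+-identityʳ b)) (trans (cong (λ z → b ℤ.+ z) h) (cancel b u))
          where
          cancel : ∀ b u → b ℤ.+ (ℤ.- b ℤ.+ u) ≡ u
          cancel = solve-∀
      b-below : + B n (suc m) m ≡ + colSum A N m ℤ.- Σbelow
      b-below = solve-neg (+ B n (suc m) m) (+ colSum A N m) Σbelow
                  (trans up-from-last (cong (λ z → ℤ.- + z ℤ.+ Σbelow) (b-penultRow n m 3≤n (s≤s z≤n) (s≤s (ℕP.m≤m+n m' d)))))
        where
        solve-neg : ∀ b c L → ℤ.- b ≡ ℤ.- c ℤ.+ L → b ≡ c ℤ.- L
        solve-neg b c L h = trans (double-neg b) (trans (cong ℤ.-_ h) (neg-distrib c L))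
          where
          double-neg : ∀ b → b ≡ ℤ.- (ℤ.- b)
          double-neg = solve-∀
          neg-distrib : ∀ c L → ℤ.- (ℤ.- c ℤ.+ L) ≡ c ℤ.- L
          neg-distrib = solve-∀
      colSum-split′ : + colSum A N m ≡ Σabove ℤ.+ (+ A N m m ℤ.+ (Σbelow ℤ.+ + 0))
      colSum-split′ = trans (+Σ₁≡Σ< N (λ i → A N i m))
               (trans (cong (λ z → Σ< z (λ i → + A N (suc i) m)) (sym (trans (ℕP.+-suc m' (suc d)) (cong suc (ℕP.+-suc m' d)))))
                (trans (Σ<-+-split m' (suc (suc d)) (λ i → + A N (suc i) m))
                 (cong (λ z → Σabove ℤ.+ z)
                  (trans (Σ<-suc (suc d) _)
                   (cong₂ ℤ._+_ (cong (λ z → + A N (suc z) m) (ℕP.+-identityʳ m'))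
                    (cong₂ ℤ._+_ (Σ<-cong d (λ i → cong (λ z → + A N (suc z) m) (ℕP.+-suc m' i)))
                                 (cong +_ (trans (cong₃ A refl (cong suc (ℕP.+-suc m' d)) refl)
                                                 (lastRowA-zero N m (s≤s (s≤s z≤n)) (s≤s z≤n) (ℕP.≤-trans (ℕP.n≤1+n m) m<N))))))))))
      regroup : ∀ u a l → u ℤ.+ (a ℤ.+ (l ℤ.+ + 0)) ℤ.- l ≡ u ℤ.+ a
      regroup = solve-∀

  splitAt-diagonal : ∀ m' N → suc (suc m') ≤ N → suc (suc (m' + (N ∸ suc (suc m')))) ≡ N
  splitAt-diagonal m' N = ℕP.m+[n∸m]≡n

  2≤i+2 : ∀ i → 2 ≤ suc i + 1
  2≤i+2 i = s≤s (subst (1 ≤_) (sym (m+1≡suc i)) (s≤s z≤n))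
  i+2≤m : ∀ i m' → i < m' → suc i + 1 ≤ suc m'
  i+2≤m i m' i<m' = s≤s (subst (_≤ m') (sym (m+1≡suc i)) i<m')
  3≤m+2 : ∀ m' → 3 ≤ suc m' + 2
  3≤m+2 m' = s≤s (ℕP.m≤n+m 2 m')
  m+2≤i : ∀ m' i → suc m' < i → suc m' + 2 ≤ suc i
  m+2≤i m' i m<i = s≤s (subst (_≤ i) (sym (ℕP.+-comm m' 2)) m<i)
  ≤-pred∸1 : ∀ m N → suc m ≤ N → m ≤ N ∸ 1
  ≤-pred∸1 m (suc N) (s≤s m≤N) = m≤N

  -- Consecutive rows of A_n (resp. B_n) differ entrywise by a row of B_{n-1} (resp. A_{n-1}), shifted
  -- by one column past the diagonal; the two near-diagonal entries account for the rest.
  rowSumA-step : ∀ N m' → 2 ≤ N → m' < N →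
    + rowSum A (suc N) (suc m') ≡ + rowSum A (suc N) (suc (suc m')) ℤ.+ + rowSum B N (suc m')
  rowSumA-step N m' 2≤N m'<N =
    from-difference (+ rowSum A n m) (+ rowSum A n (suc m)) (+ rowSum B N m) (trans (sym (rowSum-difference (suc N) (λ k → A n m k) (λ k → A n (suc m) k)))
                   (trans (Σ<-splice D v m' N m'<N below above)
                     (trans (reassoc₄ (Σ< N v) (D m') (D (suc m')) (v m'))
                     (cong₂ ℤ._+_ (sym (+Σ₁≡Σ< N (λ k → B N m k))) boundaryTerms))))
    where
    n m : ℕ
    n = suc N
    m = suc m'
    3≤n : 3 ≤ n
    3≤n = s≤s 2≤N
    D v : ℕ → ℤ
    D i = + A n m (suc i) ℤ.- + A n (suc m) (suc i)
    v i = + B N m (suc i)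
    below : ∀ i → i < m' → D i ≡ v i
    below i i<m' = trans (cong (λ z → + z ℤ.- + A n (suc m) (suc i))
                          (trans (a-step-below n m (suc i) 3≤n (2≤i+2 i) (i+2≤m i m' i<m') m'<N)
                                 (cong (λ z → z + B N m (suc i)) (cong₃ A refl (m+1≡suc m) refl))))
                        (pos-+-sub-cancel (A n (suc m) (suc i)) (B N m (suc i)))
    above : ∀ i → m' < i → i < N → D (suc i) ≡ v i
    above i m'<i i<N with ℕP.m≤n⇒m<n∨m≡n i<N
    ... | inj₁ si<N = trans (cong (λ z → + z ℤ.- + A n (suc m) (suc (suc i)))
                              (trans (a-step-above n m (suc (suc i)) 3≤n (3≤m+2 m') (m+2≤i m' (suc i) (s≤s m'<i)) si<N)
                                     (cong (λ z → z + B N m (suc i)) (cong₃ A refl (m+1≡suc m) refl))))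
                            (pos-+-sub-cancel (A n (suc m) (suc (suc i))) (B N m (suc i)))
    ... | inj₂ refl = trans (cong₂ (λ x y → + x ℤ.- + y)
                              (proj₁ (lastCol-zero n m 3≤n (s≤s z≤n) (ℕP.≤-trans m'<N (ℕP.n≤1+n N))))
                              (proj₁ (lastCol-zero n (suc m) 3≤n (s≤s z≤n) (s≤s m'<N))))
                            (sym (cong +_ (lastColB-zero N m 2≤N (s≤s z≤n) m'<N)))
    diagₘ : + A n m m ≡ + 0
    diagₘ = cong +_ (a-diag n m (ℕP.≤-trans (s≤s (s≤s z≤n)) 3≤n) (s≤s z≤n) (ℕP.≤-trans m'<N (ℕP.n≤1+n N)) (λ { (e , _) → ℕP.<-irrefl (sym e) 3≤n }))
    diagₘ₊₁ : + A n (suc m) (suc m) ≡ + 0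
    diagₘ₊₁ = cong +_ (a-diag n (suc m) (ℕP.≤-trans (s≤s (s≤s z≤n)) 3≤n) (s≤s z≤n) (s≤s m'<N) (λ { (e , _) → ℕP.<-irrefl (sym e) 3≤n }))
    diagᵥ : v m' ≡ + 0
    diagᵥ = cong +_ (b-diag N m 2≤N (s≤s z≤n) m'<N)
    nearDiagonal : + A n m (suc m) ≡ + A n (suc m) m
    nearDiagonal with ℕP.m≤n⇒m<n∨m≡n m'<N
    ... | inj₁ m<N = subst (λ N → + A (suc N) m (suc m) ≡ + A (suc N) (suc m) m) (splitAt-diagonal m' N m<N) (NearDiagonal.a-nearDiagonal m' (N ∸ suc (suc m')))
    ... | inj₂ refl = trans (cong +_ (proj₁ (lastCol-zero n m 3≤n (s≤s z≤n) (ℕP.n≤1+n m))))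
                        (sym (cong +_ (proj₁ (edgeRow-zero n m 3≤n (s≤s z≤n) (ℕP.n≤1+n m)))))
    boundaryTerms : D m' ℤ.+ D (suc m') ℤ.- v m' ≡ + 0
    boundaryTerms = trans (cong₃ (λ x y z → x ℤ.+ y ℤ.- z) (cong (λ z → z ℤ.- + A n (suc m) m) diagₘ) (cong (λ z → + A n m (suc m) ℤ.- z) diagₘ₊₁) diagᵥ)
                 (trans (cong (λ z → (+ 0 ℤ.- + A n (suc m) m) ℤ.+ (z ℤ.- + 0) ℤ.- + 0) nearDiagonal) (cancel (+ A n (suc m) m)))
      where
      cancel : ∀ a → (+ 0 ℤ.- a) ℤ.+ (a ℤ.- + 0) ℤ.- + 0 ≡ + 0
      cancel = solve-∀

  rowSumB-step : ∀ N m' → 2 ≤ N → suc (suc m') ≤ N →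
    + rowSum B (suc N) (suc (suc m')) ≡ + rowSum B (suc N) (suc m') ℤ.+ + rowSum A N (suc m')
  rowSumB-step N m' 2≤N m+1<N =
    from-difference (+ rowSum B n (suc m)) (+ rowSum B n m) (+ rowSum A N m)
             (trans (sym (rowSum-difference (suc N) (λ k → B n (suc m) k) (λ k → B n m k)))
                   (trans (Σ<-splice D v m' N m'<N below above)
                     (trans (reassoc₄ (Σ< N v) (D m') (D (suc m')) (v m'))
                     (cong₂ ℤ._+_ (sym (+Σ₁≡Σ< N (λ k → A N m k))) boundaryTerms))))
    where
    n m : ℕ
    n = suc N
    m = suc m'
    m'<N : m' < N
    m'<N = ℕP.<-trans (ℕP.n<1+n m') m+1<N
    3≤n : 3 ≤ n
    3≤n = s≤s 2≤N
    D v : ℕ → ℤ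
    D i = + B n (suc m) (suc i) ℤ.- + B n m (suc i)
    v i = + A N m (suc i)
    below : ∀ i → i < m' → D i ≡ v i
    below i i<m' = trans (cong (λ z → + z ℤ.- + B n m (suc i))
                          (trans (cong₃ B refl (sym (m+1≡suc m)) refl) (b-step-below n m (suc i) 3≤n (2≤i+2 i) (i+2≤m i m' i<m') (≤-pred∸1 m N m+1<N))))
                        (pos-+-sub-cancel (B n m (suc i)) (A N m (suc i)))
    above : ∀ i → m' < i → i < N → D (suc i) ≡ v i
    above i m'<i i<N with ℕP.m≤n⇒m<n∨m≡n i<N
    ... | inj₁ si<N = trans (cong (λ z → + z ℤ.- + B n m (suc (suc i)))
                              (trans (cong₃ B refl (sym (m+1≡suc m)) refl)
                                     (b-step-above n m (suc (suc i)) 3≤n (3≤m+2 m') (m+2≤i m' (suc i) (s≤s m'<i)) si<N)))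
                            (pos-+-sub-cancel (B n m (suc (suc i))) (A N m (suc i)))
    ... | inj₂ refl = trans (cong₂ (λ x y → + x ℤ.- + y)
                              (proj₂ (lastCol-zero n (suc m) 3≤n (s≤s z≤n) (s≤s m'<N)))
                              (proj₂ (lastCol-zero n m 3≤n (s≤s z≤n) (ℕP.≤-trans m'<N (ℕP.n≤1+n N)))))
                            (sym (cong +_ (lastColA-zero N m 2≤N (s≤s z≤n) m'<N)))
    diagₘ : + B n m m ≡ + 0
    diagₘ = cong +_ (b-diag n m (ℕP.≤-trans (s≤s (s≤s z≤n)) 3≤n) (s≤s z≤n) (ℕP.≤-trans m'<N (ℕP.n≤1+n N)))
    diagₘ₊₁ : + B n (suc m) (suc m) ≡ + 0
    diagₘ₊₁ = cong +_ (b-diag n (suc m) (ℕP.≤-trans (s≤s (s≤s z≤n)) 3≤n) (s≤s z≤n) (s≤s m'<N))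
    nearDiagonal : + B n (suc m) m ≡ + B n m (suc m) ℤ.+ + A N m m
    nearDiagonal = subst (λ N → + B (suc N) (suc m) m ≡ + B (suc N) m (suc m) ℤ.+ + A N m m) (splitAt-diagonal m' N m+1<N) (NearDiagonal.b-nearDiagonal m' (N ∸ suc (suc m')))
    boundaryTerms : D m' ℤ.+ D (suc m') ℤ.- v m' ≡ + 0
    boundaryTerms = trans (cong₂ (λ x y → (+ B n (suc m) m ℤ.- x) ℤ.+ (y ℤ.- + B n m (suc m)) ℤ.- + A N m m) diagₘ diagₘ₊₁)
                 (trans (cong (λ z → (z ℤ.- + 0) ℤ.+ (+ 0 ℤ.- + B n m (suc m)) ℤ.- + A N m m) nearDiagonal) (cancel (+ B n m (suc m)) (+ A N m m)))
      where
      cancel : ∀ b a → (b ℤ.+ a ℤ.- + 0) ℤ.+ (+ 0 ℤ.- b) ℤ.- a ≡ + 0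
      cancel = solve-∀

  rowSumB-last : ∀ N' → 1 ≤ N' → + rowSum B (suc (suc N')) (suc (suc N')) ≡ + rowSum B (suc (suc N')) (suc N')
  rowSumB-last N' 1≤N' =
    trans (+Σ₁≡Σ< n (λ k → B n n k))
     (trans (Σ<-suc (suc N') _)
      (trans (cong₂ ℤ._+_ (cong +_ (b-corner n 3≤n))
                         (cong₂ ℤ._+_ (Σ<-cong< N' (λ i h → cong +_ (b-lastRow n (suc (suc i)) 3≤n (s≤s (s≤s z≤n)) (s≤s h))))
                                      (cong +_ (proj₂ (lastCol-zero n n 3≤n (s≤s z≤n) ℕP.≤-refl)))))
       (trans (regroup (Σ< N' (λ i → + colSum A N (suc i))))
        (sym (trans (+Σ₁≡Σ< n (λ k → B n N k))
               (cong₂ ℤ._+_ (cong₂ ℤ._+_ (Σ<-cong< N' (λ i h → cong +_ (b-penultRow n (suc i) 3≤n (s≤s z≤n) h)))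
                                         (cong +_ (b-diag n N (ℕP.≤-trans (s≤s (s≤s z≤n)) 3≤n) (s≤s z≤n) (ℕP.n≤1+n N))))
                            (cong +_ (proj₂ (lastCol-zero n N 3≤n (s≤s z≤n) (ℕP.n≤1+n N))))))))))
    where
    N n : ℕ
    N = suc N'
    n = suc N
    3≤n : 3 ≤ n
    3≤n = s≤s (s≤s 1≤N')
    regroup : ∀ S → + 0 ℤ.+ (S ℤ.+ + 0) ≡ S ℤ.+ + 0 ℤ.+ + 0
    regroup = solve-∀

  rowSumA-last : ∀ N → 2 ≤ N → + rowSum A N N ≡ + 0
  rowSumA-last N 2≤N = trans (+Σ₁≡Σ< N (λ k → A N N k)) (Σ<-zero N _ (λ i h → cong +_ (lastRowA-zero N (suc i) 2≤N (s≤s z≤n) h)))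


downwardInduction : (P : ℕ → Set) → ∀ n → P n → (∀ m → m < n → P (suc m) → P m) → ∀ m → m ≤ n → P m
downwardInduction P n Pn step m m≤n = go (n ∸ m) m (ℕP.m+[n∸m]≡n m≤n)
  where
  go : ∀ d m → m + d ≡ n → P m
  go zero    m m+0≡n = subst P (sym (trans (sym (ℕP.+-identityʳ m)) m+0≡n)) Pn
  go (suc d) m m+d≡n = step m (subst (m <_) m+d≡n (ℕP.m<m+n m (s≤s z≤n))) (go d (suc m) (trans (sym (ℕP.+-suc m d)) m+d≡n))

solveFor-middle : ∀ x y z → x ℤ.- y ℤ.+ z ≡ + 0 → y ≡ x ℤ.+ z
solveFor-middle x y z eq = trans (sym (ℤP.+-identityˡ y)) (trans (cong (λ w → w ℤ.+ y) (sym eq)) (regroup x y z))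
  where
  regroup : ∀ x y z → x ℤ.- y ℤ.+ z ℤ.+ y ≡ x ℤ.+ z
  regroup = solve-∀

module Induction (F : ℕ → ℕ → ℤ) (isE : IsEntringer F) (A B : Mat) (ts : IsTwinSeidel A B) where
  open EntringerArray F isE
  open Defects F isE using (defects-vanish)
  open TwinSeidel A B ts

  SumsAt : ℕ → Set
  SumsAt n = (∀ m → 1 ≤ m → m ≤ n → (+ rowSum A n m ≡ F n m) × (+ rowSum B n m ≡ F n (n + 1 ∸ m)))
           × (∀ k → 1 ≤ k → k ≤ n → (+ colSum A n k ≡ withZero F n (n ∸ k)) × (+ colSum B n k ≡ withZero F n (n ∸ k)))

  SumsBelow : ℕ → Set
  SumsBelow N = ∀ n → 2 ≤ n → n ≤ N → SumsAt n

  withZero-suc : ∀ L c x → L ∸ c ≡ suc x → withZero F L (L ∸ c) ≡ F L (suc x)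
  withZero-suc L c x eq rewrite eq = refl

  γ-entringer : ∀ kk rr → SumsBelow (kk + suc rr) → ∀ j → j ≤ rr → LowerChain.γ kk j ≡ Φ j kk
  γ-entringer zero rr ih zero _ = trans (cong +_ (proj₁ (proj₂ (proj₂ B₂)))) (sym F-1-1)
  γ-entringer zero rr ih (suc j) _ =
    trans (cong +_ (b-corner (suc (suc j + 1)) (s≤s (s≤s (subst (1 ≤_) (sym (ℕP.+-comm j 1)) (s≤s z≤n))))))
          (sym (Φ-boundary (suc j)))
  γ-entringer (suc kk) rr ih j j≤rr =
    trans (cong +_ (b-lastRow (suc L) (suc (suc kk)) 3≤L+1 (s≤s (s≤s z≤n)) (ℕP.m≤n+m (suc (suc kk)) j)))
     (trans (proj₁ (proj₂ (ih L 2≤L L≤N) (suc kk) (s≤s z≤n) (ℕP.≤-trans (ℕP.n≤1+n (suc kk)) (ℕP.m≤n+m (suc (suc kk)) j))))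
      (trans (withZero-suc L (suc kk) j (trans (cong (_∸ suc kk) (+-suc-comm j (suc kk))) (ℕP.m+n∸m≡n (suc kk) (suc j))))
             (cong (λ z → F z (suc j)) (ℕP.+-suc j (suc kk)))))
    where
    L : ℕ
    L = j + suc (suc kk)
    2≤L : 2 ≤ L
    2≤L = ℕP.≤-trans (s≤s (s≤s z≤n)) (ℕP.m≤n+m (suc (suc kk)) j)
    3≤L+1 : 3 ≤ suc L
    3≤L+1 = s≤s 2≤L
    L≤N : L ≤ suc kk + suc rr
    L≤N = ℕP.≤-trans (ℕP.+-monoˡ-≤ (suc (suc kk)) j≤rr) (ℕP.≤-reflexive (+-suc-comm rr (suc kk)))

  colSums-entringer : ∀ kk rr → 3 ≤ suc kk + suc rr → SumsBelow (kk + suc rr) →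
                      (+ colSum A (suc kk + suc rr) (suc kk) ≡ Φ rr (suc kk))
                      × (+ colSum B (suc kk + suc rr) (suc kk) ≡ Φ rr (suc kk))
  colSums-entringer kk rr 3≤n ih = colSumA≡Φ , colSumB≡Φ
    where
    open ColumnSums kk rr 3≤n
    open UpperChain rr using (α)
    open LowerChain kk using (γ; ρ)
    N : ℕ
    N = kk + suc rr
    α′ γ′ ρ′ : ℕ → ℤ
    α′ j = Φ rr (suc j)
    γ′ j = Φ j kk
    ρ′ j = Φ j (suc kk)

    α≡α′ : ∀ j → j < kk → α j ≡ α′ j
    α≡α′ j j<kk = trans (proj₂ (proj₂ (ih L 2≤L L≤N) (suc j) (s≤s z≤n) (ℕP.m≤m+n (suc j) (suc rr))))
                   (trans (withZero-suc L (suc j) rr (ℕP.m+n∸m≡n (suc j) (suc rr)))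
                          (cong (λ z → F (suc z) (suc rr)) (+-suc-comm j rr)))
      where
      L : ℕ
      L = suc j + suc rr
      2≤L : 2 ≤ L
      2≤L = s≤s (subst (1 ≤_) (sym (ℕP.+-suc j rr)) (s≤s z≤n))
      L≤N : L ≤ N
      L≤N = ℕP.+-monoˡ-≤ (suc rr) j<kk

    γ≡γ′ : ∀ j → j ≤ rr → γ j ≡ γ′ j
    γ≡γ′ = γ-entringer kk rr ih

    ρ≡ρ′ : ∀ j → j < rr → ρ j ≡ ρ′ j
    ρ≡ρ′ j j<rr = trans (proj₁ (proj₂ (ih L 2≤L L≤N) (suc kk) (s≤s z≤n) (ℕP.≤-trans (ℕP.m≤n+m (suc kk) j) (ℕP.n≤1+n _))))
                        (withZero-suc L (suc kk) j (trans (cong (_∸ kk) (+-suc-comm j kk)) (ℕP.m+n∸m≡n kk (suc j))))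
      where
      L : ℕ
      L = suc (j + suc kk)
      2≤L : 2 ≤ L
      2≤L = s≤s (ℕP.≤-trans (s≤s z≤n) (ℕP.m≤n+m (suc kk) j))
      L≤N : L ≤ N
      L≤N = ℕP.≤-trans (ℕP.+-monoˡ-≤ (suc kk) j<rr) (ℕP.≤-reflexive (+-suc-comm rr kk))

    δ₀₀-vanishes : ∀ kk rr → 3 ≤ suc kk + suc rr → δ₀₀ rr kk ≡ + 0
    δ₀₀-vanishes kk      (suc rr) _ = refl
    δ₀₀-vanishes (suc kk) zero    _ = refl
    δ₀₀-vanishes zero     zero    (s≤s (s≤s ()))

    colSumA≡Φ : + colSum A (suc kk + suc rr) (suc kk) ≡ Φ rr (suc kk)
    colSumA≡Φ = trans colA-formula
      (trans (cong₂ ℤ._+_ (conv-congˡ< sinD kk α≡α′ refl)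
                (cong₂ ℤ._+_ (conv-congˡ< sinD rr (λ j j<rr → γ≡γ′ j (ℕP.<⇒≤ j<rr)) refl)
                             (sub-conv-congˡ< ρ ρ′ cosD rr refl ρ≡ρ′)))
             (conclude (conv α′ sinD kk) (conv γ′ sinD rr) (ρ′ rr) (conv ρ′ cosD rr)
                  (trans (cong (λ z → conv α′ sinD kk ℤ.+ conv γ′ sinD rr ℤ.- conv ρ′ cosD rr ℤ.+ z)
                               (sym (δ₀₀-vanishes kk rr 3≤n)))
                         (proj₁ (defects-vanish rr kk)))))
      where
      conclude : ∀ x y r z → x ℤ.+ y ℤ.- z ℤ.+ + 0 ≡ + 0 → x ℤ.+ (y ℤ.+ (r ℤ.- z)) ≡ r
      conclude x y r z eq = trans (regroup x y r z) (trans (cong (λ w → w ℤ.+ r) eq) (ℤP.+-identityˡ r))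
        where
        regroup : ∀ x y r z → x ℤ.+ (y ℤ.+ (r ℤ.- z)) ≡ (x ℤ.+ y ℤ.- z ℤ.+ + 0) ℤ.+ r
        regroup = solve-∀

    colSumB≡Φ : + colSum B (suc kk + suc rr) (suc kk) ≡ Φ rr (suc kk)
    colSumB≡Φ = trans colB-formula
      (trans (cong₂ ℤ._+_ (sub-conv-congˡ< α α′ cosD kk refl α≡α′)
                (cong₂ ℤ._+_ (conv-congˡ cosD rr γ≡γ′) (conv-congˡ< sinD rr ρ≡ρ′ refl)))
             (conclude (α′ kk) (conv α′ cosD kk) (conv γ′ cosD rr) (conv ρ′ sinD rr) (proj₁ (proj₂ (defects-vanish rr kk)))))
      where
      conclude : ∀ a x y z → x ℤ.- y ℤ.- z ≡ + 0 → (a ℤ.- x) ℤ.+ (y ℤ.+ z) ≡ a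
      conclude a x y z eq = trans (regroup a x y z) (trans (cong (λ w → a ℤ.- w) eq) (ℤP.+-identityʳ a))
        where
        regroup : ∀ a x y z → (a ℤ.- x) ℤ.+ (y ℤ.+ z) ≡ a ℤ.- (x ℤ.- y ℤ.- z)
        regroup = solve-∀

  F-2-1 : F 2 1 ≡ + 1
  F-2-1 = trans (sub-add-cancel (F 2 1) (F 1 1))
                (trans (cong (λ z → z ℤ.+ F 1 1) (sym (Φ-recurrence 0 0))) (cong₂ ℤ._+_ (F-diagonal 2 (s≤s (s≤s z≤n))) F-1-1))

  sums-at-2 : SumsAt 2
  sums-at-2 with A₂ | B₂
  ... | (a₁₁ , a₁₂ , a₂₁ , a₂₂) | (b₁₁ , b₁₂ , b₂₁ , b₂₂) = rows , cols
    where
    F-2-2 : F 2 2 ≡ + 0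
    F-2-2 = F-diagonal 2 (s≤s (s≤s z≤n))
    sum₂ : ∀ {x y u v} → x ≡ u → y ≡ v → + (0 + x + y) ≡ + (0 + u + v)
    sum₂ refl refl = refl
    rows : ∀ m → 1 ≤ m → m ≤ 2 → (+ rowSum A 2 m ≡ F 2 m) × (+ rowSum B 2 m ≡ F 2 (2 + 1 ∸ m))
    rows 1 _ _ = trans (sum₂ a₁₁ a₁₂) (sym F-2-1) , trans (sum₂ b₁₁ b₁₂) (sym F-2-2)
    rows 2 _ _ = trans (sum₂ a₂₁ a₂₂) (sym F-2-2) , trans (sum₂ b₂₁ b₂₂) (sym F-2-1)
    rows (suc (suc (suc m))) _ (s≤s (s≤s ()))
    cols : ∀ k → 1 ≤ k → k ≤ 2 → (+ colSum A 2 k ≡ withZero F 2 (2 ∸ k)) × (+ colSum B 2 k ≡ withZero F 2 (2 ∸ k))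
    cols 1 _ _ = trans (sum₂ a₁₁ a₂₁) (sym F-2-1) , trans (sum₂ b₁₁ b₂₁) (sym F-2-1)
    cols 2 _ _ = sum₂ a₁₂ a₂₂ , sum₂ b₁₂ b₂₂
    cols (suc (suc (suc k))) _ (s≤s (s≤s ()))

  module Step (N : ℕ) (2≤N : 2 ≤ N) (ih : SumsBelow N) where
    n : ℕ
    n = suc N
    2≤n : 2 ≤ n
    2≤n = ℕP.≤-trans 2≤N (ℕP.n≤1+n N)
    3≤n : 3 ≤ n
    3≤n = s≤s 2≤N
    sumsAtN : SumsAt N
    sumsAtN = ih N 2≤N ℕP.≤-refl

    rowSumsA : ∀ m → 1 ≤ m → m ≤ n → + rowSum A n m ≡ F n m
    rowSumsA m 1≤m m≤n = downwardInduction (λ m → 1 ≤ m → + rowSum A n m ≡ F n m) n lastRow step m m≤n 1≤m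
      where
      lastRow : 1 ≤ n → + rowSum A n n ≡ F n n
      lastRow _ = trans (rowSumA-last n 2≤n) (sym (F-diagonal n 2≤n))
      step : ∀ m → m < n → (1 ≤ suc m → + rowSum A n (suc m) ≡ F n (suc m)) → 1 ≤ m → + rowSum A n m ≡ F n m
      step (suc m) (s≤s m<N) next _ =
        trans (rowSumA-step N m 2≤N m<N)
         (trans (cong₂ ℤ._+_ (next (s≤s z≤n))
                   (trans (proj₂ (proj₁ sumsAtN (suc m) (s≤s z≤n) m<N)) (cong (λ z → F N (z ∸ suc m)) (m+1≡suc N))))
                (sym (solveFor-middle (F n (suc (suc m))) (F n (suc m)) (F N (N ∸ m)) (F-recurrence n (suc m) 2≤n (s≤s z≤n) m<N))))

    F-reflected-step : ∀ m → 1 ≤ m → m ≤ N → F n (n + 1 ∸ suc m) ≡ F n (n + 1 ∸ m) ℤ.+ F N m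
    F-reflected-step m 1≤m m≤N =
      trans (cong (λ z → F n (z ∸ suc m)) (m+1≡suc n))
       (trans (solveFor-middle (F n (suc (n ∸ m))) (F n (n ∸ m)) (F N m)
                 (trans (cong (λ z → F n (suc (n ∸ m)) ℤ.- F n (n ∸ m) ℤ.+ F N z) (sym (ℕP.m∸[m∸n]≡n m≤n)))
                        (F-recurrence n (n ∸ m) 2≤n (ℕP.m<n⇒0<n∸m (s≤s m≤N)) (ℕP.∸-monoʳ-≤ n 1≤m))))
              (cong (λ z → F n z ℤ.+ F N m) (sym (trans (cong (_∸ m) (m+1≡suc n)) (ℕP.+-∸-assoc 1 m≤n)))))
      where
      m≤n : m ≤ n
      m≤n = ℕP.≤-trans m≤N (ℕP.n≤1+n N)

    rowSumsB : ∀ m → 1 ≤ m → m ≤ n → + rowSum B n m ≡ F n (n + 1 ∸ m)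
    rowSumsB 1 _ _ =
      trans (+Σ₁≡Σ< n (λ k → B n 1 k))
       (trans (Σ<-zero n _ (λ i i<n → cong +_ (proj₂ (edgeRow-zero n (suc i) 3≤n (s≤s z≤n) i<n))))
              (sym (trans (cong (λ z → F n (z ∸ 1)) (m+1≡suc n)) (F-diagonal n 2≤n))))
    rowSumsB (suc (suc m)) _ (s≤s m<N) =
      trans rowStep (trans (cong₂ ℤ._+_ (rowSumsB (suc m) (s≤s z≤n) (ℕP.≤-trans m<N (ℕP.n≤1+n N)))
                                        (proj₁ (proj₁ sumsAtN (suc m) (s≤s z≤n) m<N)))
                           (sym (F-reflected-step (suc m) (s≤s z≤n) m<N)))
      where
      rowStep : + rowSum B n (suc (suc m)) ≡ + rowSum B n (suc m) ℤ.+ + rowSum A N (suc m)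
      rowStep with ℕP.m≤n⇒m<n∨m≡n m<N
      ... | inj₁ m+1<N = rowSumB-step N m 2≤N m+1<N
      ... | inj₂ refl = trans (rowSumB-last m (ℕP.≤-pred 2≤N))
                              (trans (sym (ℤP.+-identityʳ _)) (cong (λ z → + rowSum B n (suc m) ℤ.+ z) (sym (rowSumA-last N 2≤N))))

    colSums : ∀ k → 1 ≤ k → k ≤ n → (+ colSum A n k ≡ withZero F n (n ∸ k)) × (+ colSum B n k ≡ withZero F n (n ∸ k))
    colSums (suc kk) _ k≤n with ℕP.m≤n⇒m<n∨m≡n k≤n
    ... | inj₂ refl =
          trans (+Σ₁≡Σ< n (λ m → A n m n))
                (trans (Σ<-zero n _ (λ i i<n → cong +_ (proj₁ (lastCol-zero n (suc i) 3≤n (s≤s z≤n) i<n))))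
                       (sym (cong (withZero F n) (ℕP.n∸n≡0 n))))
        , trans (+Σ₁≡Σ< n (λ m → B n m n))
                (trans (Σ<-zero n _ (λ i i<n → cong +_ (proj₂ (lastCol-zero n (suc i) 3≤n (s≤s z≤n) i<n))))
                       (sym (cong (withZero F n) (ℕP.n∸n≡0 n))))
    ... | inj₁ (s≤s k≤N) =
          subst (λ M → (+ colSum A (suc M) (suc kk) ≡ withZero F (suc M) (suc M ∸ suc kk))
                     × (+ colSum B (suc M) (suc kk) ≡ withZero F (suc M) (suc M ∸ suc kk))) N≡
                (trans (proj₁ colSums≡Φ) (sym target) , trans (proj₂ colSums≡Φ) (sym target))
      where
      rr : ℕ
      rr = N ∸ suc kk
      N≡ : kk + suc rr ≡ N
      N≡ = trans (ℕP.+-suc kk rr) (ℕP.m+[n∸m]≡n k≤N)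
      colSums≡Φ : (+ colSum A (suc kk + suc rr) (suc kk) ≡ Φ rr (suc kk))
                  × (+ colSum B (suc kk + suc rr) (suc kk) ≡ Φ rr (suc kk))
      colSums≡Φ = colSums-entringer kk rr (subst (3 ≤_) (sym (cong suc N≡)) 3≤n)
                                     (λ n′ 2≤n′ n′≤ → ih n′ 2≤n′ (subst (n′ ≤_) N≡ n′≤))
      target : withZero F (suc (kk + suc rr)) (suc (kk + suc rr) ∸ suc kk) ≡ Φ rr (suc kk)
      target = trans (withZero-suc (suc (kk + suc rr)) (suc kk) rr (ℕP.m+n∸m≡n kk (suc rr)))
                     (cong (λ z → F (suc z) (suc rr)) (+-suc-comm kk rr))

    sums : SumsAt n
    sums = (λ m 1≤m m≤n → rowSumsA m 1≤m m≤n , rowSumsB m 1≤m m≤n) , colSums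

  twinSeidel-sums : ∀ n → 2 ≤ n → SumsAt n
  twinSeidel-sums = <-rec (λ n → 2 ≤ n → SumsAt n) sumsFromBelow
    where
    sumsFromBelow : ∀ n → (∀ {n′} → n′ < n → 2 ≤ n′ → SumsAt n′) → 2 ≤ n → SumsAt n
    sumsFromBelow 1 _ (s≤s ())
    sumsFromBelow 2 _ _ = sums-at-2
    sumsFromBelow (suc (suc (suc N))) ih _ =
      Step.sums (suc (suc N)) (s≤s (s≤s z≤n)) (λ n′ 2≤n′ n′≤N → ih (s≤s n′≤N) 2≤n′)

theorem9p1 : (E : ℕ → ℤ) → IsTanSec E →
    (F : ℕ → ℕ → ℤ) → IsEntringer F →
    ((∀ n → 1 ≤ n →
        (Σℤ₁ (2 * n ∸ 1) (F (2 * n ∸ 1)) ≡ E (2 * n ∸ 1))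
        × (Σℤ₁ (2 * n) (F (2 * n)) ≡ E (2 * n)))
    × ((A B : Mat) → IsTwinSeidel A B → ∀ n → 2 ≤ n →
        (∀ m → 1 ≤ m → m ≤ n →
            (+ rowSum A n m ≡ F n m) × (+ rowSum B n m ≡ F n (n + 1 ∸ m)))
        × (∀ k → 1 ≤ k → k ≤ n →
            (+ colSum A n k ≡ withZero F n (n ∸ k))
            × (+ colSum B n k ≡ withZero F n (n ∸ k)))))
theorem9p1 E tanSec F isE =
    (λ n 1≤n → rowSum≡E (2 * n ∸ 1) (1≤2n-1 n 1≤n) , rowSum≡E (2 * n) (1≤2n n 1≤n))
  , (λ A B ts → Induction.twinSeidel-sums F isE A B ts)
  where
  rowSum≡E : ∀ N → 1 ≤ N → Σℤ₁ N (F N) ≡ E N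
  rowSum≡E = entringer-rowSum E tanSec F isE
  1≤2n : ∀ n → 1 ≤ n → 1 ≤ 2 * n
  1≤2n n 1≤n = ℕP.≤-trans 1≤n (ℕP.m≤m+n n (n + 0))
  1≤2n-1 : ∀ n → 1 ≤ n → 1 ≤ 2 * n ∸ 1
  1≤2n-1 (suc n) _ = ℕP.≤-trans (s≤s z≤n) (ℕP.m≤n+m (suc (n + 0)) n)
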